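{- Let $\Gamma=(V,E)$ be a directed graph with $[n]\subseteq V$, let $w:E\to\mathbb R$ be edge weights such that $\Gamma$ has no directed cycle of negative total weight, and let $S_1\subset\dots\subset S_s$ be subsets of $V$ with $|S_k|=d_k$, where $d_1<\dots<d_s$, such that for each $k$ some subset of $[n]$ of size $d_k$ has a linking onto $S_k$. For each $k$ and $I\in\binom{[n]}{d_k}$ let $\mu_k(I)$ be the minimum weight of a linking from $I$ onto $S_k$ ($\infty$ if none exists). Then $(\mu_1,\dots,\mu_s)$ is a valuated flag matroid of rank $(d_1,\dots,d_s)$ on $[n]$.
   Context: For $I,J\subseteq V$ with $|I|=|J|$, a linking from $I$ onto $J$ is a collection of $|I|$ pairwise vertex-disjoint directed paths, each starting at a vertex of $I$ and ending at a vertex of $J$ (a path may have length zero); its weight is the sum of the weights of all edges used. A valuated matroid of rank $d$ on $[n]$ is a function $\mu:\binom{[n]}{d}\to\mathbb R\cup\{\infty\}$, not identically $\infty$, such that for all $S\in\binom{[n]}{d-1}$, $T\in\binom{[n]}{d+1}$ the minimum of $\mu(S\cup\{j\})+\mu(T\setminus\{j\})$ over $j\in T\setminus S$ is $\infty$ or attained at least twice. A valuated flag matroid of rank $(d_1<\dots<d_s)$ is a tuple $(\mu_1,\dots,\mu_s)$ of valuated matroids of ranks $d_k$ such that for all $k<l$, $S\in\binom{[n]}{d_k-1}$, $T\in\binom{[n]}{d_l+1}$, the minimum of $\mu_k(S\cup\{j\})+\mu_l(T\setminus\{j\})$ over $j\in T\setminus S$ is $\infty$ or attained at least twice. -}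

module Defs where

open import Level using (Level; _⊔_) renaming (suc to lsuc)
open import Data.Nat using (ℕ; zero; suc) renaming (_+_ to _+ℕ_; _<_ to _<ℕ_)
open import Data.Fin using (Fin; inject+) renaming (_<_ to _<F_)
open import Data.Fin.Subset using (Subset; _∈_; _∉_; _⊆_; _∪_; _-_; ⁅_⁆; ∣_∣)
open import Data.Vec using (_++_; replicate)
open import Data.Bool using (false)
open import Data.List using (List; []; _∷_; map; length; foldr; concatMap)
open import Data.List.Relation.Unary.All using (All)
open import Data.List.Relation.Unary.Unique.Propositional using (Unique)
open import Data.List.Relation.Unary.AllPairs using (AllPairs)
open import Data.List.Membership.Propositional using () renaming (_∈_ to _∈L_)
open import Data.Product using (Σ; ∃; _×_; _,_)
open import Data.Sum using (_⊎_)
open import Data.Empty using (⊥)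
open import Relation.Nullary using (¬_)
open import Relation.Binary.PropositionalEquality using (_≡_; _≢_)
open import Relation.Binary.Structures using (IsTotalOrder)
open import Algebra.Structures using (IsAbelianGroup)

-- Totally ordered abelian groups (weights live here; ℝ is an instance).

record OrderedAbelianGroup c ℓ : Set (lsuc (c ⊔ ℓ)) where
  infixl 6 _+_
  infix  4 _≤_
  field
    Carrier : Set c
    _+_     : Carrier → Carrier → Carrier
    0#      : Carrier
    neg     : Carrier → Carrier
    _≤_     : Carrier → Carrier → Set ℓ
    isAbelianGroup : IsAbelianGroup _≡_ _+_ 0# neg
    isTotalOrder   : IsTotalOrder _≡_ _≤_
    +-monoˡ-≤      : ∀ {x y} z → x ≤ y → x + z ≤ y + z

module _ {c ℓ} (G : OrderedAbelianGroup c ℓ) where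
  open OrderedAbelianGroup G

  data G∞ : Set c where
    fin : Carrier → G∞
    ∞   : G∞

  infixl 6 _+∞_
  _+∞_ : G∞ → G∞ → G∞
  fin x +∞ fin y = fin (x + y)
  fin x +∞ ∞     = ∞
  ∞     +∞ _     = ∞

  infix 4 _≤∞_
  data _≤∞_ : G∞ → G∞ → Set (c ⊔ ℓ) where
    fin≤fin : ∀ {x y} → x ≤ y → fin x ≤∞ fin y
    _≤∞∞    : ∀ x → x ≤∞ ∞

  MinInfOrTwice : ∀ {n} → Subset n → Subset n → (Fin n → G∞) → Set (c ⊔ ℓ)
  MinInfOrTwice {n} S T f =
    (∀ j → j ∈ T → j ∉ S → f j ≡ ∞)
    ⊎ Σ (Fin n) λ j → Σ (Fin n) λ j′ →
        j ≢ j′ × j ∈ T × j ∉ S × j′ ∈ T × j′ ∉ S × f j ≡ f j′ ×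
        (∀ i → i ∈ T → i ∉ S → f j ≤∞ f i)

  -- Valuated matroids and valuated flag matroids on [n] (= Fin n).
  -- μ is given on all subsets; only its values on d-subsets matter.

  IsValuatedMatroid : (n d : ℕ) → (Subset n → G∞) → Set (c ⊔ ℓ)
  IsValuatedMatroid n d μ =
    (Σ (Subset n) λ B → ∣ B ∣ ≡ d × μ B ≢ ∞)
    × (∀ (S T : Subset n) → suc ∣ S ∣ ≡ d → ∣ T ∣ ≡ suc d →
         MinInfOrTwice S T (λ j → μ (S ∪ ⁅ j ⁆) +∞ μ (T - j)))

  IsValuatedFlagMatroid : (n s : ℕ) (d : Fin s → ℕ) → (Fin s → Subset n → G∞) → Set (c ⊔ ℓ)
  IsValuatedFlagMatroid n s d μ =
    (∀ k → IsValuatedMatroid n (d k) (μ k))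
    × (∀ k l → k <F l → ∀ (S T : Subset n) → suc ∣ S ∣ ≡ d k → ∣ T ∣ ≡ suc (d l) →
         MinInfOrTwice S T (λ j → μ k (S ∪ ⁅ j ⁆) +∞ μ l (T - j)))

record Digraph (m : ℕ) : Set where
  field
    nE  : ℕ
    src : Fin nE → Fin m
    tgt : Fin nE → Fin m

module _ {m : ℕ} (Γ : Digraph m) where
  open Digraph Γ

  IsWalkFrom : Fin m → List (Fin nE) → Set
  IsWalkFrom v []       = Data.Unit.⊤ where import Data.Unit
  IsWalkFrom v (e ∷ es) = src e ≡ v × IsWalkFrom (tgt e) es

  walkEnd : Fin m → List (Fin nE) → Fin m
  walkEnd v []       = v
  walkEnd v (e ∷ es) = walkEnd (tgt e) es

  record Path : Set where
    field
      start : Fin m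
      edges : List (Fin nE)
      walk  : IsWalkFrom start edges
      simple : Unique (start ∷ map tgt edges)

  pathVertices : Path → List (Fin m)
  pathVertices p = Path.start p ∷ map tgt (Path.edges p)

  pathEnd : Path → Fin m
  pathEnd p = walkEnd (Path.start p) (Path.edges p)

  record Cycle : Set where
    field
      start : Fin m
      edges : List (Fin nE)
      nonempty : edges ≢ []
      walk  : IsWalkFrom start edges
      closed : walkEnd start edges ≡ start
      simple : Unique (map tgt edges)

  Disjoint : List (Fin m) → List (Fin m) → Set
  Disjoint xs ys = ∀ {v} → v ∈L xs → v ∈L ys → ⊥

  record Linking (A B : Subset m) : Set where
    field
      paths    : List Path
      count    : length paths ≡ ∣ A ∣
      disjoint : AllPairs (λ p q → Disjoint (pathVertices p) (pathVertices q)) paths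
      starts   : All (λ p → Path.start p ∈ A) paths
      ends     : All (λ p → pathEnd p ∈ B) paths

module _ {c ℓ} (G : OrderedAbelianGroup c ℓ) {m : ℕ} (Γ : Digraph m)
         (w : Fin (Digraph.nE Γ) → OrderedAbelianGroup.Carrier G) where
  open OrderedAbelianGroup G

  edgesWeight : List (Fin (Digraph.nE Γ)) → Carrier
  edgesWeight = foldr (λ e r → w e + r) 0#

  linkingWeight : ∀ {A B} → Linking Γ A B → Carrier
  linkingWeight L = foldr (λ p r → edgesWeight (Path.edges p) + r) 0# (Linking.paths L)

  NoNegativeCycle : Set ℓ
  NoNegativeCycle = (C : Cycle Γ) → 0# ≤ edgesWeight (Cycle.edges C)

  IsMinLinkingWeight : Subset m → Subset m → G∞ G → Set (c ⊔ ℓ)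
  IsMinLinkingWeight A B x =
    ((Linking Γ A B → ⊥) × x ≡ ∞)
    ⊎ Σ (Linking Γ A B) λ L → x ≡ fin (linkingWeight L) ×
        (∀ (L′ : Linking Γ A B) → linkingWeight L ≤ linkingWeight L′)

-- [n] ⊆ V: we take V = Fin (n + r) with [n] the first n vertices
-- (inject+ r); a subset I ⊆ [n] is viewed in V as I ++ (false …).

embedSub : ∀ {n} r → Subset n → Subset (n +ℕ r)
embedSub r I = I ++ replicate _ false

-- A linking from I onto S k is encoded as a flow: a successor map σ on the vertices together with
-- the edge used at each moved vertex, forming disjoint paths out of I and possibly cycles.  Given
-- optimal linkings for X ∪ {j} → S k and Y - j → S l (S k ⊆ S l), walk from j alternately
-- backwards along the second flow and forwards along the first until a source t ≠ j of the second
-- is met; swapping the edges leaving the vertices on this walk yields flows for X ∪ {t} → S k and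
-- Y - t → S l with the same edges in total.  Splitting off the cycles, which have nonnegative
-- weight, turns flows back into linkings, so μ k (X ∪ {t}) + μ l (Y - t) ≤ μ k (X ∪ {j}) + μ l (Y - j).
-- At a minimising j this says the minimum is attained twice.

module Submission where

open import Defs
open import Level using (_⊔_)
open import Function.Base using (_∘_; _$_)
open import Data.Empty using (⊥; ⊥-elim)
open import Data.Unit using (⊤; tt)
open import Data.Product using (Σ; ∃; ∃₂; _×_; _,_; proj₁; proj₂)
import Data.Product
open import Data.Sum using (_⊎_; inj₁; inj₂; [_,_])
import Data.Sum
open import Data.Maybe using (Maybe; just; nothing; maybe)
open import Data.Nat as ℕ using (ℕ; zero; suc; _≤_; _<_; z≤n; s≤s; s≤s⁻¹; z<s)
import Data.Nat.Properties as ℕP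
open import Data.Nat.GeneralisedArithmetic using (fold)
open import Data.Fin using (Fin; zero; suc; toℕ; _↑ˡ_) renaming (_<_ to _<F_; _≤_ to _≤F_)
open import Data.Fin.Properties using (pigeonhole; toℕ<n; any?; suc-injective; ↑ˡ-injective) renaming (_≟_ to _≟F_)
open import Data.Vec using ([]; _∷_)
open import Data.Vec.Base using (here; there)
open import Data.Fin.Subset using (Subset; _∈_; _∉_; _⊆_; _∪_; _-_; ⁅_⁆; ∣_∣; inside; outside; Nonempty)
  renaming (⊥ to ∅)
open import Data.Fin.Subset.Properties
  using (_∈?_; ∉⊥; ∣⊥∣≡0; p─⊥≡p; Empty-unique; ∪-identityʳ; x∈p∪q⁻; x∈p∪q⁺; x∈⁅x⁆; x∈⁅y⁆⇒x≡y;
         x∈p∧x≢y⇒x∈p-y; p⊆q⇒∣p∣≤∣q∣; ∣⁅x⁆∣≡1)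
open import Data.List as List using (List; []; _∷_; length; map; foldr; applyUpTo; allFin)
open import Data.List.Membership.Propositional using () renaming (_∈_ to _∈L_; _∉_ to _∉L_)
import Data.List.Relation.Unary.Any as ListAny
open import Data.List.Relation.Unary.All as All using (All; []; _∷_)
open import Data.List.Relation.Unary.Unique.Propositional using (Unique)
import Data.List.Relation.Unary.Unique.Propositional.Properties as Uniqueₚ
import Data.List.Relation.Unary.All.Properties as Allₚ
open import Data.List.Membership.Propositional.Properties
  using (∈-applyUpTo⁺; ∈-applyUpTo⁻; ∈-map⁺; ∈-map⁻; ∈-++⁺ˡ; ∈-++⁺ʳ; ∈-++⁻; ∈-allFin)
open import Data.List.Properties using (map-++; length-map)
import Data.List.Relation.Unary.AllPairs.Properties as AllPairsₚ
open import Data.List.Relation.Unary.AllPairs as AllPairs using (AllPairs; []; _∷_)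
open import Algebra.Bundles using (CommutativeMonoid)
open import Algebra.Properties.CommutativeMonoid.Sum ℕP.+-0-commutativeMonoid using () renaming (sum to sumℕ)
open import Algebra.Structures using (IsAbelianGroup)
open import Relation.Binary.Structures using (IsTotalOrder)
open import Relation.Nullary using (¬_; Dec; yes; no; _×-dec_; ¬?)
open import Relation.Binary.PropositionalEquality
  using (_≡_; _≢_; refl; sym; trans; cong; cong₂; subst; subst₂; module ≡-Reasoning)
open import Relation.Binary.Definitions using (tri<; tri≈; tri>)

select : ∀ {p} {X : Set} {A : Set p} → Dec X → A → A → A
select (yes _) a b = a
select (no _)  a b = b

select-yes : ∀ {p} {X : Set} {A : Set p} (d : Dec X) {a b : A} → X → select d a b ≡ a
select-yes (yes _) _ = refl
select-yes (no ¬x) x = ⊥-elim (¬x x)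

select-no : ∀ {p} {X : Set} {A : Set p} (d : Dec X) {a b : A} → ¬ X → select d a b ≡ b
select-no (yes x) ¬x = ⊥-elim (¬x x)
select-no (no _)  _  = refl

just? : ∀ {A : Set} (x : Maybe A) → Dec (∃ λ a → x ≡ just a)
just? (just a) = yes (a , refl)
just? nothing  = no λ ()

not-just : ∀ {A : Set} {x : Maybe A} → ¬ (∃ λ a → x ≡ just a) → x ≡ nothing
not-just {x = just a}  ¬just = ⊥-elim (¬just (a , refl))
not-just {x = nothing} _     = refl

map-unique⇒injective : ∀ {A B : Set} (f : A → B) xs {a b} → Unique (map f xs) →
                       a ∈L xs → b ∈L xs → f a ≡ f b → a ≡ b
map-unique⇒injective f (x ∷ xs) _           (ListAny.here refl) (ListAny.here refl) _  = refl
map-unique⇒injective f (x ∷ xs) (x∉ ∷ _)   (ListAny.here refl) (ListAny.there b∈) eq =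
  ⊥-elim (All.lookup x∉ (∈-map⁺ f b∈) eq)
map-unique⇒injective f (x ∷ xs) (x∉ ∷ _)   (ListAny.there a∈) (ListAny.here refl) eq =
  ⊥-elim (All.lookup x∉ (∈-map⁺ f a∈) (sym eq))
map-unique⇒injective f (x ∷ xs) (_ ∷ uniq) (ListAny.there a∈) (ListAny.there b∈) eq =
  map-unique⇒injective f xs uniq a∈ b∈ eq

find-just : ∀ {A : Set} {P : A → Set} (P? : ∀ a → Dec (P a)) xs {a} → List.find P? xs ≡ just a → a ∈L xs × P a
find-just P? (x ∷ xs) eq with P? x
find-just P? (x ∷ xs) refl | yes px = ListAny.here refl , px
... | no _ = Data.Product.map₁ ListAny.there (find-just P? xs eq)

find-nothing : ∀ {A : Set} {P : A → Set} (P? : ∀ a → Dec (P a)) xs → List.find P? xs ≡ nothing →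
               ∀ {a} → a ∈L xs → ¬ P a
find-nothing P? (x ∷ xs) eq a∈ with P? x
find-nothing P? (x ∷ xs) () a∈                  | yes _
find-nothing P? (x ∷ xs) eq (ListAny.here refl) | no ¬px = ¬px
find-nothing P? (x ∷ xs) eq (ListAny.there a∈)  | no _   = find-nothing P? xs eq a∈

-- Orbits of self-maps of finite sets

InjectiveOn : ∀ {m} → (Fin m → Set) → (Fin m → Fin m) → Set
InjectiveOn D f = ∀ x y → D x → D y → f x ≡ f y → x ≡ y

fold-suc-inner : ∀ {A : Set} (x : A) f b → fold x f (suc b) ≡ fold (f x) f b
fold-suc-inner x f zero    = refl
fold-suc-inner x f (suc b) = cong f (fold-suc-inner x f b)

least? : ∀ {P : ℕ → Set} → (∀ n → Dec (P n)) → ∀ n →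
         (∃ λ k → k ≤ n × P k × (∀ i → i < k → ¬ P i)) ⊎ (∀ i → i ≤ n → ¬ P i)
least? P? zero with P? zero
... | yes p  = inj₁ (0 , z≤n , p , λ _ ())
... | no ¬p = inj₂ λ { zero _ → ¬p }
least? P? (suc n) with least? P? n
... | inj₁ (k , k≤n , p , below) = inj₁ (k , ℕP.m≤n⇒m≤1+n k≤n , p , below)
... | inj₂ none with P? (suc n)
...   | yes p  = inj₁ (suc n , ℕP.≤-refl , p , λ i i<1+n → none i (s≤s⁻¹ i<1+n))
...   | no ¬p = inj₂ λ i i≤1+n → [ (λ i<1+n → none i (s≤s⁻¹ i<1+n)) , (λ { refl → ¬p }) ]
                                   (ℕP.m≤n⇒m<n∨m≡n i≤1+n)

sumℕ-mono-≤ : ∀ {n} (f g : Fin n → ℕ) → (∀ u → f u ≤ g u) → sumℕ f ≤ sumℕ g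
sumℕ-mono-≤ {zero}  f g f≤g = z≤n
sumℕ-mono-≤ {suc n} f g f≤g = ℕP.+-mono-≤ (f≤g zero) (sumℕ-mono-≤ (f ∘ suc) (g ∘ suc) (f≤g ∘ suc))

sumℕ-mono-< : ∀ {n} (f g : Fin n → ℕ) → (∀ u → f u ≤ g u) → ∀ u₀ → f u₀ < g u₀ → sumℕ f < sumℕ g
sumℕ-mono-< {suc n} f g f≤g zero     f<g = ℕP.+-mono-<-≤ f<g (sumℕ-mono-≤ (f ∘ suc) (g ∘ suc) (f≤g ∘ suc))
sumℕ-mono-< {suc n} f g f≤g (suc u₀) f<g =
  ℕP.+-mono-≤-< (f≤g zero) (sumℕ-mono-< (f ∘ suc) (g ∘ suc) (f≤g ∘ suc) u₀ f<g)

module Orbit {m : ℕ} (f : Fin m → Fin m) (x : Fin m) where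

  orbit : ℕ → Fin m
  orbit a = fold x f a

  InjectiveUpTo : ℕ → Set
  InjectiveUpTo k = ∀ a b → a ≤ k → b ≤ k → orbit a ≡ orbit b → a ≡ b

  injectiveUpTo : ∀ k → (∀ a b → a < b → b ≤ k → orbit a ≢ orbit b) → InjectiveUpTo k
  injectiveUpTo k distinct a b a≤k b≤k eq with ℕP.<-cmp a b
  ... | tri< a<b _ _ = ⊥-elim (distinct a b a<b b≤k eq)
  ... | tri≈ _ a≡b _ = a≡b
  ... | tri> _ _ b<a = ⊥-elim (distinct b a b<a a≤k (sym eq))

  orbit-segment-unique : ∀ {k n} → InjectiveUpTo k → n ≤ suc k → Unique (applyUpTo orbit n)
  orbit-segment-unique {k} {n} injective n≤1+k = Uniqueₚ.applyUpTo⁺₁ orbit n λ i<j j<n eq →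
    ℕP.<⇒≢ i<j (injective _ _ (s≤s⁻¹ (ℕP.<-≤-trans (ℕP.<-trans i<j j<n) n≤1+k))
                              (s≤s⁻¹ (ℕP.<-≤-trans j<n n≤1+k)) eq)

  orbit-cancel : ∀ {D} → InjectiveOn D f → ∀ a d → (∀ i → i < a ℕ.+ d → D (orbit i)) →
                 orbit a ≡ orbit (a ℕ.+ d) → x ≡ orbit d
  orbit-cancel f-inj zero    d _  eq = eq
  orbit-cancel f-inj (suc a) d inD eq =
    orbit-cancel f-inj a d (λ i i< → inD i (ℕP.m≤n⇒m≤1+n i<))
      (f-inj _ _ (inD a (s≤s (ℕP.m≤m+n a d))) (inD (a ℕ.+ d) ℕP.≤-refl) eq)

  orbit-collision : ∀ {D} → InjectiveOn D f → ∀ {a b} → a < b → (∀ i → i < b → D (orbit i)) →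
                    orbit a ≡ orbit b → ∃ λ d → suc d ≤ b × x ≡ orbit (suc d)
  orbit-collision f-inj {a} {b} a<b inD eq with ℕP.m≤n⇒∃[o]m+o≡n a<b
  ... | d , refl = d , s≤s (ℕP.m≤n+m d a) ,
    orbit-cancel f-inj a (suc d) (λ i i< → inD i (subst (i <_) (ℕP.+-suc a d) i<))
                 (trans eq (cong orbit (sym (ℕP.+-suc a d))))

  orbit-returns : InjectiveOn (λ _ → ⊤) f → ∃ λ c → orbit (suc c) ≡ x
  orbit-returns f-inj with pigeonhole (ℕP.n<1+n m) (orbit ∘ toℕ)
  ... | i , j , i<j , eq with orbit-collision f-inj i<j (λ _ _ → tt) eq
  ...   | d , _ , x≡ = d , sym x≡

  module _ (Stop : Fin m → Set) (Stop? : ∀ y → Dec (Stop y))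
           (f-inj : InjectiveOn (λ y → ¬ Stop y) f)
           (x-unreached : ∀ y → ¬ Stop y → f y ≢ x) where

    private
      distinct : ∀ k → (∀ i → i < k → ¬ Stop (orbit i)) → ∀ a b → a < b → b ≤ k → orbit a ≢ orbit b
      distinct k moving a b a<b b≤k eq with orbit-collision f-inj a<b (λ i i<b → moving i (ℕP.<-≤-trans i<b b≤k)) eq
      ... | d , d<b , x≡ = x-unreached (orbit d) (moving d (ℕP.<-≤-trans d<b b≤k)) (sym x≡)

    orbit-stops : ∃ λ k → Stop (orbit k) × (∀ i → i < k → ¬ Stop (orbit i)) × InjectiveUpTo k
    orbit-stops with least? (λ a → Stop? (orbit a)) m
    ... | inj₁ (k , _ , stop , moving) = k , stop , moving , injectiveUpTo k (distinct k moving)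
    ... | inj₂ never with pigeonhole (ℕP.n<1+n m) (orbit ∘ toℕ)
    ...   | i , j , i<j , eq = ⊥-elim (distinct m (λ a a<m → never a (ℕP.<⇒≤ a<m)) (toℕ i) (toℕ j) i<j
                                                 (s≤s⁻¹ (toℕ<n j)) eq)

  orbit-period : ∀ {D} → InjectiveOn D f → ∀ L → orbit (suc L) ≡ x → (∀ b → b ≤ L → D (orbit b)) →
                 ∃ λ c → orbit (suc c) ≡ x × c ≤ L × InjectiveUpTo c
  orbit-period f-inj L ret inD with least? (λ a → orbit (suc a) ≟F x) L
  ... | inj₂ never = ⊥-elim (never L ℕP.≤-refl ret)
  ... | inj₁ (c , c≤L , ret-c , minimal) = c , ret-c , c≤L , injectiveUpTo c distinct
    where
    distinct : ∀ a b → a < b → b ≤ c → orbit a ≢ orbit b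
    distinct a b a<b b≤c eq with orbit-collision f-inj a<b
                                   (λ i i<b → inD i (ℕP.≤-trans (ℕP.<⇒≤ i<b) (ℕP.≤-trans b≤c c≤L))) eq
    ... | d , d<b , x≡ = minimal d (ℕP.<-≤-trans d<b b≤c) (sym x≡)

x∈p-y⇒x∈p×x≢y : ∀ {n} (p : Subset n) y {x} → x ∈ p - y → x ∈ p × x ≢ y
x∈p-y⇒x∈p×x≢y (b ∷ p)      zero    {suc x} (there x∈) = there (subst (x ∈_) (p─⊥≡p p) x∈) , λ ()
x∈p-y⇒x∈p×x≢y (inside ∷ p) (suc y) {zero}  here       = here , λ ()
x∈p-y⇒x∈p×x≢y (b ∷ p)      (suc y) {suc x} (there x∈) with x∈p-y⇒x∈p×x≢y p y x∈
... | x∈p , x≢y = there x∈p , x≢y ∘ suc-injective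

x∈p⇒∣p-x∣+1≡∣p∣ : ∀ {n} (p : Subset n) {x} → x ∈ p → suc ∣ p - x ∣ ≡ ∣ p ∣
x∈p⇒∣p-x∣+1≡∣p∣ (inside ∷ p)  {zero}  here       = cong (suc ∘ ∣_∣) (p─⊥≡p p)
x∈p⇒∣p-x∣+1≡∣p∣ (outside ∷ p) {suc x} (there x∈) = x∈p⇒∣p-x∣+1≡∣p∣ p x∈
x∈p⇒∣p-x∣+1≡∣p∣ (inside ∷ p)  {suc x} (there x∈) = cong suc (x∈p⇒∣p-x∣+1≡∣p∣ p x∈)

x∉p⇒∣p∪⁅x⁆∣≡∣p∣+1 : ∀ {n} (p : Subset n) {x} → x ∉ p → ∣ p ∪ ⁅ x ⁆ ∣ ≡ suc ∣ p ∣
x∉p⇒∣p∪⁅x⁆∣≡∣p∣+1 (inside ∷ p)  {zero}  x∉ = ⊥-elim (x∉ here)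
x∉p⇒∣p∪⁅x⁆∣≡∣p∣+1 (outside ∷ p) {zero}  x∉ = cong (suc ∘ ∣_∣) (∪-identityʳ p)
x∉p⇒∣p∪⁅x⁆∣≡∣p∣+1 (inside ∷ p)  {suc x} x∉ = cong suc (x∉p⇒∣p∪⁅x⁆∣≡∣p∣+1 p (x∉ ∘ there))
x∉p⇒∣p∪⁅x⁆∣≡∣p∣+1 (outside ∷ p) {suc x} x∉ = x∉p⇒∣p∪⁅x⁆∣≡∣p∣+1 p (x∉ ∘ there)

∣p∣≡0⇒x∉p : ∀ {n} (p : Subset n) → ∣ p ∣ ≡ 0 → ∀ x → x ∉ p
∣p∣≡0⇒x∉p p ∣p∣≡0 x x∈p = ℕP.<-irrefl (sym ∣p∣≡0) (subst (_≤ ∣ p ∣) (∣⁅x⁆∣≡1 x)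
  (p⊆q⇒∣p∣≤∣q∣ (λ y∈⁅x⁆ → subst (_∈ p) (sym (x∈⁅y⁆⇒x≡y x y∈⁅x⁆)) x∈p)))

∣p∣≡1+k⇒Nonempty : ∀ {n} (p : Subset n) {k} → ∣ p ∣ ≡ suc k → Nonempty p
∣p∣≡1+k⇒Nonempty {n} p ∣p∣≡1+k with any? (_∈? p)
... | yes nonempty = nonempty
... | no empty = ⊥-elim (ℕP.0≢1+n (trans (sym (trans (cong ∣_∣ (Empty-unique empty)) (∣⊥∣≡0 n))) ∣p∣≡1+k))

x∈p∪⁅y⁆⁻ : ∀ {n} (p : Subset n) y {x} → x ∈ p ∪ ⁅ y ⁆ → x ∈ p ⊎ x ≡ y
x∈p∪⁅y⁆⁻ p y x∈ = Data.Sum.map₂ (x∈⁅y⁆⇒x≡y y) (x∈p∪q⁻ p ⁅ y ⁆ x∈)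

x∈p∪⁅y⁆⁺ : ∀ {n} (p : Subset n) y {x} → x ∈ p ⊎ x ≡ y → x ∈ p ∪ ⁅ y ⁆
x∈p∪⁅y⁆⁺ p y (inj₁ x∈p)  = x∈p∪q⁺ (inj₁ x∈p)
x∈p∪⁅y⁆⁺ p y (inj₂ refl) = x∈p∪q⁺ (inj₂ (x∈⁅x⁆ y))

∈-embedSub⁻ : ∀ {n} r (I : Subset n) {v} → v ∈ embedSub r I → ∃ λ i → v ≡ i ↑ˡ r × i ∈ I
∈-embedSub⁻ {zero}  r []           v∈        = ⊥-elim (∉⊥ v∈)
∈-embedSub⁻ {suc n} r (inside ∷ I) here      = zero , refl , here
∈-embedSub⁻ {suc n} r (b ∷ I)      (there v∈) with ∈-embedSub⁻ r I v∈
... | i , refl , i∈ = suc i , refl , there i∈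

∈-embedSub⁺ : ∀ {n} r (I : Subset n) {i} → i ∈ I → i ↑ˡ r ∈ embedSub r I
∈-embedSub⁺ r (b ∷ I) here       = here
∈-embedSub⁺ r (b ∷ I) (there i∈) = there (∈-embedSub⁺ r I i∈)

∣embedSub∣ : ∀ {n} r (I : Subset n) → ∣ embedSub r I ∣ ≡ ∣ I ∣
∣embedSub∣ {zero}  r []            = ∣⊥∣≡0 r
∣embedSub∣ {suc n} r (inside ∷ I)  = cong suc (∣embedSub∣ r I)
∣embedSub∣ {suc n} r (outside ∷ I) = ∣embedSub∣ r I

∈-embedSub∪⁅⁆⁻ : ∀ {n} r (X : Subset n) j {v} → v ∈ embedSub r (X ∪ ⁅ j ⁆) → v ≡ j ↑ˡ r ⊎ v ∈ embedSub r X
∈-embedSub∪⁅⁆⁻ r X j v∈ with ∈-embedSub⁻ r (X ∪ ⁅ j ⁆) v∈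
... | i , refl , i∈ = Data.Sum.map (cong (_↑ˡ r)) (∈-embedSub⁺ r X) (Data.Sum.swap (x∈p∪⁅y⁆⁻ X j i∈))

∈-embedSub∪⁅⁆⁺ : ∀ {n} r (X : Subset n) j {v} → v ≡ j ↑ˡ r ⊎ v ∈ embedSub r X → v ∈ embedSub r (X ∪ ⁅ j ⁆)
∈-embedSub∪⁅⁆⁺ r X j (inj₁ refl) = ∈-embedSub⁺ r (X ∪ ⁅ j ⁆) (x∈p∪⁅y⁆⁺ X j (inj₂ refl))
∈-embedSub∪⁅⁆⁺ r X j (inj₂ v∈) with ∈-embedSub⁻ r X v∈
... | i , refl , i∈ = ∈-embedSub⁺ r (X ∪ ⁅ j ⁆) (x∈p∪⁅y⁆⁺ X j (inj₁ i∈))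

∈-embedSub-⁻ : ∀ {n} r (Y : Subset n) j {v} → v ∈ embedSub r (Y - j) → v ∈ embedSub r Y × v ≢ j ↑ˡ r
∈-embedSub-⁻ r Y j v∈ with ∈-embedSub⁻ r (Y - j) v∈
... | i , refl , i∈ = ∈-embedSub⁺ r Y (proj₁ (x∈p-y⇒x∈p×x≢y Y j i∈)) ,
                      proj₂ (x∈p-y⇒x∈p×x≢y Y j i∈) ∘ ↑ˡ-injective r i j

∈-embedSub-⁺ : ∀ {n} r (Y : Subset n) j {v} → v ∈ embedSub r Y × v ≢ j ↑ˡ r → v ∈ embedSub r (Y - j)
∈-embedSub-⁺ r Y j (v∈ , v≢j) with ∈-embedSub⁻ r Y v∈
... | i , refl , i∈ = ∈-embedSub⁺ r (Y - j) (x∈p∧x≢y⇒x∈p-y i∈ (v≢j ∘ cong (_↑ˡ r)))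

fromList : ∀ {n} → List (Fin n) → Subset n
fromList []       = ∅
fromList (x ∷ xs) = fromList xs ∪ ⁅ x ⁆

∈-fromList⁻ : ∀ {n} (xs : List (Fin n)) {v} → v ∈ fromList xs → v ∈L xs
∈-fromList⁻ []       v∈ = ⊥-elim (∉⊥ v∈)
∈-fromList⁻ (x ∷ xs) v∈ with x∈p∪⁅y⁆⁻ (fromList xs) x v∈
... | inj₁ v∈xs = ListAny.there (∈-fromList⁻ xs v∈xs)
... | inj₂ v≡x  = ListAny.here v≡x

∣fromList∣ : ∀ {n} (xs : List (Fin n)) → Unique xs → ∣ fromList xs ∣ ≡ length xs
∣fromList∣ {n} []       _            = ∣⊥∣≡0 n
∣fromList∣     (x ∷ xs) (x∉xs ∷ uxs) =
  trans (x∉p⇒∣p∪⁅x⁆∣≡∣p∣+1 (fromList xs) (λ x∈ → All.lookup x∉xs (∈-fromList⁻ xs x∈) refl))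
        (cong suc (∣fromList∣ xs uxs))

∈-saturatedList : ∀ {n} (A : Subset n) (xs : List (Fin n)) → Unique xs → All (_∈ A) xs →
                  length xs ≡ ∣ A ∣ → ∀ {v} → v ∈ A → v ∈L xs
∈-saturatedList A xs uxs xs⊆A len {v} v∈A with ListAny.any? (v ≟F_) xs
... | yes v∈xs = v∈xs
... | no  v∉xs = ⊥-elim $ ℕP.<-irrefl refl (ℕP.≤-trans (subst (_≤ ∣ A ∣) ∣v∷xs∣ (p⊆q⇒∣p∣≤∣q∣ v∷xs⊆A))
                                            (ℕP.≤-reflexive (sym len)))
  where
  v∷xs⊆A : fromList (v ∷ xs) ⊆ A
  v∷xs⊆A y∈ = All.lookup (v∈A ∷ xs⊆A) (∈-fromList⁻ (v ∷ xs) y∈)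
  ∣v∷xs∣ : ∣ fromList (v ∷ xs) ∣ ≡ suc (length xs)
  ∣v∷xs∣ = ∣fromList∣ (v ∷ xs) (All.tabulate (λ y∈ v≡y → v∉xs (subst (_∈L xs) (sym v≡y) y∈)) ∷ uxs)

module Walks {m : ℕ} (Γ : Digraph m) where
  open Digraph Γ

  walkVertices : Fin m → List (Fin nE) → List (Fin m)
  walkVertices x es = x ∷ map tgt es

  ∈-walk-src : ∀ x es {e} → IsWalkFrom Γ x es → e ∈L es → src e ∈L walkVertices x es
  ∈-walk-src x (e ∷ es) (src≡x , _)    (ListAny.here refl) = ListAny.here src≡x
  ∈-walk-src x (e ∷ es) (_     , walk) (ListAny.there e∈) = ListAny.there (∈-walk-src (tgt e) es walk e∈)

  ∈-walk-tgt : ∀ x es {e} → e ∈L es → tgt e ∈L walkVertices x es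
  ∈-walk-tgt x es e∈ = ListAny.there (∈-map⁺ tgt e∈)

  ∈-walk-end : ∀ x es → walkEnd Γ x es ∈L walkVertices x es
  ∈-walk-end x []       = ListAny.here refl
  ∈-walk-end x (e ∷ es) = ListAny.there (∈-walk-end (tgt e) es)

  walk-src≢end : ∀ x es {e} → IsWalkFrom Γ x es → Unique (walkVertices x es) → e ∈L es → src e ≢ walkEnd Γ x es
  walk-src≢end x (e ∷ es) (src≡x , _) (x∉ ∷ _) (ListAny.here refl) eq =
    All.lookup x∉ (∈-walk-end (tgt e) es) (trans (sym src≡x) eq)
  walk-src≢end x (e ∷ es) (_ , walk) (_ ∷ uniq) (ListAny.there e∈) = walk-src≢end (tgt e) es walk uniq e∈

  walk-tgt≢start : ∀ x es {e} → Unique (walkVertices x es) → e ∈L es → tgt e ≢ x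
  walk-tgt≢start x es (x∉ ∷ _) e∈ eq = All.lookup x∉ (∈-map⁺ tgt e∈) (sym eq)

  walk-tgt≢src : ∀ x es {e} → IsWalkFrom Γ x es → Unique (walkVertices x es) → e ∈L es → tgt e ≢ src e
  walk-tgt≢src x (e ∷ es) (src≡x , _) (x∉ ∷ _) (ListAny.here refl) eq =
    All.lookup x∉ (ListAny.here refl) (sym (trans eq src≡x))
  walk-tgt≢src x (e ∷ es) (_ , walk) (_ ∷ uniq) (ListAny.there e∈) = walk-tgt≢src (tgt e) es walk uniq e∈

  walk-leaves : ∀ x es {v} → IsWalkFrom Γ x es → v ∈L walkVertices x es → v ≢ walkEnd Γ x es →
                ∃ λ e → e ∈L es × src e ≡ v
  walk-leaves x []       _            (ListAny.here refl) v≢end = ⊥-elim (v≢end refl)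
  walk-leaves x (e ∷ es) (src≡x , _)  (ListAny.here refl) _     = e , ListAny.here refl , src≡x
  walk-leaves x (e ∷ es) (_ , walk)   (ListAny.there v∈)  v≢end with walk-leaves (tgt e) es walk v∈ v≢end
  ... | e′ , e′∈ , src≡v = e′ , ListAny.there e′∈ , src≡v

  walk-enters : ∀ x es {v} → v ∈L walkVertices x es → v ≢ x → ∃ λ e → e ∈L es × tgt e ≡ v
  walk-enters x es (ListAny.here refl) v≢x = ⊥-elim (v≢x refl)
  walk-enters x es (ListAny.there v∈)  _   with ∈-map⁻ tgt v∈
  ... | e , e∈ , v≡tgt = e , e∈ , sym v≡tgt

  walk-srcs-unique : ∀ x es → IsWalkFrom Γ x es → Unique (walkVertices x es) → Unique (map src es)
  walk-srcs-unique x []       _            _            = []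
  walk-srcs-unique x (e ∷ es) (src≡x , walk) (x∉ ∷ uniq) =
    All.tabulate src-fresh ∷ walk-srcs-unique (tgt e) es walk uniq
    where
    src-fresh : ∀ {y} → y ∈L map src es → src e ≢ y
    src-fresh y∈ eq with ∈-map⁻ src y∈
    ... | e′ , e′∈ , refl = All.lookup x∉ (∈-walk-src (tgt e) es walk e′∈) (trans (sym src≡x) eq)

-- Flows

module _ {m : ℕ} (Γ : Digraph m) where
  open Digraph Γ

  -- A vertex-disjoint union of I–J paths and cycles, encoded by the successor map σ (a bijection
  -- V ∖ J → V ∖ I with inverse τ, the identity on J) and the edge used at each moved vertex.
  record Flow (I J : Fin m → Set) : Set where
    field
      σ τ          : Fin m → Fin m
      edge         : Fin m → Maybe (Fin nE)
      σ-fixes      : ∀ u → J u → σ u ≡ u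
      σ-avoids     : ∀ u → ¬ J u → ¬ I (σ u)
      τ-avoids     : ∀ v → ¬ I v → ¬ J (τ v)
      τ∘σ          : ∀ u → ¬ J u → τ (σ u) ≡ u
      σ∘τ          : ∀ v → ¬ I v → σ (τ v) ≡ v
      edge-nothing : ∀ u → edge u ≡ nothing → σ u ≡ u
      edge-just    : ∀ u e → edge u ≡ just e → src e ≡ u × tgt e ≡ σ u × σ u ≢ u

    σ-injective : InjectiveOn (λ u → ¬ J u) σ
    σ-injective x y x∉J y∉J eq = trans (sym (τ∘σ x x∉J)) (trans (cong τ eq) (τ∘σ y y∉J))

    τ-injective : InjectiveOn (λ v → ¬ I v) τ
    τ-injective x y x∉I y∉I eq = trans (sym (σ∘τ x x∉I)) (trans (cong σ eq) (σ∘τ y y∉I))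

  reindexSources : ∀ {I I′ J} → (∀ {v} → I′ v → I v) → (∀ {v} → I v → I′ v) → Flow I J → Flow I′ J
  reindexSources I′⊆I I⊆I′ M = record
    { σ = σ ; τ = τ ; edge = edge
    ; σ-fixes      = σ-fixes
    ; σ-avoids     = λ u u∉J → σ-avoids u u∉J ∘ I′⊆I
    ; τ-avoids     = λ v v∉I′ → τ-avoids v (v∉I′ ∘ I⊆I′)
    ; τ∘σ          = τ∘σ
    ; σ∘τ          = λ v v∉I′ → σ∘τ v (v∉I′ ∘ I⊆I′)
    ; edge-nothing = edge-nothing
    ; edge-just    = edge-just }
    where open Flow M

  EdgesSwapped : ∀ {I₁ J₁ I₂ J₂ I₁′ J₁′ I₂′ J₂′} →
                 Flow I₁ J₁ → Flow I₂ J₂ → Flow I₁′ J₁′ → Flow I₂′ J₂′ → Set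
  EdgesSwapped M₁ M₂ M₁′ M₂′ = ∀ u →
    (edge M₁′ u ≡ edge M₁ u × edge M₂′ u ≡ edge M₂ u) ⊎ (edge M₁′ u ≡ edge M₂ u × edge M₂′ u ≡ edge M₁ u)
    where open Flow

  hasEdge? : ∀ {I J} (M : Flow I J) → (∀ u → Flow.edge M u ≡ nothing) ⊎ ∃₂ λ u e → Flow.edge M u ≡ just e
  hasEdge? M with any? (λ u → just? (Flow.edge M u))
  ... | yes (u , e , edge-u) = inj₂ (u , e , edge-u)
  ... | no none               = inj₁ λ u → not-just (λ just-e → none (u , just-e))

  -- Walk from j alternately backwards along M₂ and forwards along M₁, v ↦ σ₁ (τ₂ v), until a
  -- source t of M₂ is reached.  Exchanging the M₁- and M₂-edges leaving the vertices τ₂ v on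
  -- this walk turns M₁ into a flow from t + P and M₂ into one from Q - t.
  module Exchange (P Q A B : Fin m → Set) (Q? : ∀ v → Dec (Q v)) (A⊆B : ∀ {v} → A v → B v)
                  (j : Fin m) (j∈Q : Q j) (j∉P : ¬ P j)
                  (M₁ : Flow (λ v → v ≡ j ⊎ P v) A) (M₂ : Flow (λ v → Q v × v ≢ j) B) where
    open Flow M₁ using () renaming
      (σ to σ₁; τ to τ₁; edge to edge₁; σ-fixes to σ₁-fixes; σ-avoids to σ₁-avoids; τ-avoids to τ₁-avoids;
       τ∘σ to τ₁∘σ₁; σ∘τ to σ₁∘τ₁; edge-nothing to edge₁-nothing; edge-just to edge₁-just;
       σ-injective to σ₁-injective)
    open Flow M₂ using () renaming
      (σ to σ₂; τ to τ₂; edge to edge₂; σ-fixes to σ₂-fixes; σ-avoids to σ₂-avoids; τ-avoids to τ₂-avoids;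
       τ∘σ to τ₂∘σ₂; σ∘τ to σ₂∘τ₂; edge-nothing to edge₂-nothing; edge-just to edge₂-just;
       σ-injective to σ₂-injective; τ-injective to τ₂-injective)

    Src₂ : Fin m → Set
    Src₂ v = Q v × v ≢ j

    step : Fin m → Fin m
    step v = σ₁ (τ₂ v)

    τ₂∉A : ∀ {v} → ¬ Src₂ v → ¬ A (τ₂ v)
    τ₂∉A v∉ = τ₂-avoids _ v∉ ∘ A⊆B

    step-injective : InjectiveOn (λ v → ¬ Src₂ v) step
    step-injective x y x∉ y∉ eq = τ₂-injective x y x∉ y∉ (σ₁-injective _ _ (τ₂∉A x∉) (τ₂∉A y∉) eq)

    step≢j : ∀ v → ¬ Src₂ v → step v ≢ j
    step≢j v v∉ eq = σ₁-avoids (τ₂ v) (τ₂∉A v∉) (inj₁ eq)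

    open Orbit step j using (InjectiveUpTo) renaming (orbit to walk)

    opaque
      stops : ∃ λ k → Src₂ (walk k) × (∀ a → a < k → ¬ Src₂ (walk a)) × InjectiveUpTo k
      stops = Orbit.orbit-stops step j Src₂ (λ v → Q? v ×-dec ¬? (v ≟F j)) step-injective step≢j

    k : ℕ
    k = proj₁ stops

    t : Fin m
    t = walk k

    t∈Src₂ : Src₂ t
    t∈Src₂ = proj₁ (proj₂ stops)

    moving : ∀ a → a < k → ¬ Src₂ (walk a)
    moving = proj₁ (proj₂ (proj₂ stops))

    walk-injective : InjectiveUpTo k
    walk-injective = proj₂ (proj₂ (proj₂ stops))

    k-1 : ℕ
    k-1 = ℕ.pred k

    k≡1+k-1 : k ≡ suc k-1
    k≡1+k-1 with k | t∈Src₂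
    ... | zero  | (_ , j≢j) = ⊥-elim (j≢j refl)
    ... | suc _ | _         = refl

    k-1<k : k-1 < k
    k-1<k = subst (k-1 <_) (sym k≡1+k-1) ℕP.≤-refl

    0<k : 0 < k
    0<k = subst (0 <_) (sym k≡1+k-1) z<s

    t≡step : t ≡ step (walk k-1)
    t≡step = cong walk k≡1+k-1

    τ₂walk∉B : ∀ a → a < k → ¬ B (τ₂ (walk a))
    τ₂walk∉B a a<k = τ₂-avoids (walk a) (moving a a<k)

    τ₂walk∉A : ∀ a → a < k → ¬ A (τ₂ (walk a))
    τ₂walk∉A a a<k = τ₂walk∉B a a<k ∘ A⊆B

    σ₂τ₂walk : ∀ a → a < k → σ₂ (τ₂ (walk a)) ≡ walk a
    σ₂τ₂walk a a<k = σ₂∘τ₂ (walk a) (moving a a<k)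

    τ₁walk : ∀ a → a < k → τ₁ (walk (suc a)) ≡ τ₂ (walk a)
    τ₁walk a a<k = τ₁∘σ₁ (τ₂ (walk a)) (τ₂walk∉A a a<k)

    walk∉Src₁ : ∀ a → a < k → ¬ (walk (suc a) ≡ j ⊎ P (walk (suc a)))
    walk∉Src₁ a a<k = σ₁-avoids (τ₂ (walk a)) (τ₂walk∉A a a<k)

    t∉P : ¬ P t
    t∉P t∈P = walk∉Src₁ k-1 k-1<k (inj₂ (subst P t≡step t∈P))

    Visited Visited⁻ Visited⁺ : Fin m → Set
    Visited  u = ∃ λ a → a < k × τ₂ (walk a) ≡ u
    Visited⁻ v = ∃ λ a → a < k × walk a ≡ v
    Visited⁺ v = ∃ λ a → a < k × walk (suc a) ≡ v

    visited? : ∀ u → Dec (Visited u)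
    visited? u = ℕP.anyUpTo? (λ a → τ₂ (walk a) ≟F u) k

    visited⁻? : ∀ v → Dec (Visited⁻ v)
    visited⁻? v = ℕP.anyUpTo? (λ a → walk a ≟F v) k

    visited⁺? : ∀ v → Dec (Visited⁺ v)
    visited⁺? v = ℕP.anyUpTo? (λ a → walk (suc a) ≟F v) k

    Src₁′ Src₂′ : Fin m → Set
    Src₁′ v = v ≡ t ⊎ P v
    Src₂′ v = Q v × v ≢ t

    σ₁′ τ₁′ σ₂′ τ₂′ : Fin m → Fin m
    σ₁′ u = select (visited? u)  (σ₂ u) (σ₁ u)
    τ₁′ v = select (visited⁻? v) (τ₂ v) (τ₁ v)
    σ₂′ u = select (visited? u)  (σ₁ u) (σ₂ u)
    τ₂′ v = select (visited⁺? v) (τ₁ v) (τ₂ v)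

    edge₁′ edge₂′ : Fin m → Maybe (Fin nE)
    edge₁′ u = select (visited? u) (edge₂ u) (edge₁ u)
    edge₂′ u = select (visited? u) (edge₁ u) (edge₂ u)

    ∉Src₁ : ∀ {v} → ¬ Src₁′ v → ¬ Visited⁻ v → ¬ (v ≡ j ⊎ P v)
    ∉Src₁ v∉ unvisited (inj₁ v≡j) = unvisited (0 , 0<k , sym v≡j)
    ∉Src₁ v∉ unvisited (inj₂ v∈P) = v∉ (inj₂ v∈P)

    walk∉Src₁′ : ∀ a → a < k → ¬ Src₁′ (walk a)
    walk∉Src₁′ a       a<k (inj₁ eq) = ℕP.<-irrefl (walk-injective a k (ℕP.<⇒≤ a<k) ℕP.≤-refl eq) a<k
    walk∉Src₁′ zero    a<k (inj₂ j∈P) = j∉P j∈P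
    walk∉Src₁′ (suc a) a<k (inj₂ w∈P) = walk∉Src₁ a (ℕP.<-trans (ℕP.n<1+n a) a<k) (inj₂ w∈P)

    σ₁′-fixes : ∀ u → A u → σ₁′ u ≡ u
    σ₁′-fixes u u∈A with visited? u
    ... | yes (a , a<k , refl) = ⊥-elim (τ₂walk∉A a a<k u∈A)
    ... | no _                 = σ₁-fixes u u∈A

    σ₁′-avoids : ∀ u → ¬ A u → ¬ Src₁′ (σ₁′ u)
    σ₁′-avoids u u∉A with visited? u
    ... | yes (a , a<k , refl) = walk∉Src₁′ a a<k ∘ subst Src₁′ (σ₂τ₂walk a a<k)
    ... | no unvisited = λ
      { (inj₁ σ₁u≡t) → unvisited (k-1 , k-1<k ,
          sym (σ₁-injective u _ u∉A (τ₂walk∉A k-1 k-1<k) (trans σ₁u≡t t≡step)))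
      ; (inj₂ σ₁u∈P) → σ₁-avoids u u∉A (inj₂ σ₁u∈P) }

    τ₁′-avoids : ∀ v → ¬ Src₁′ v → ¬ A (τ₁′ v)
    τ₁′-avoids v v∉ with visited⁻? v
    ... | yes (a , a<k , refl) = τ₂walk∉A a a<k
    ... | no unvisited         = τ₁-avoids v (∉Src₁ v∉ unvisited)

    τ₁′∘σ₁′ : ∀ u → ¬ A u → τ₁′ (σ₁′ u) ≡ u
    τ₁′∘σ₁′ u u∉A with visited? u
    ... | yes (a , a<k , refl) =
      trans (cong τ₁′ (σ₂τ₂walk a a<k)) (select-yes (visited⁻? (walk a)) (a , a<k , refl))
    ... | no unvisited = trans (select-no (visited⁻? (σ₁ u)) σ₁u-unvisited) (τ₁∘σ₁ u u∉A)
      where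
      σ₁u-unvisited : ¬ Visited⁻ (σ₁ u)
      σ₁u-unvisited (zero , _ , j≡σ₁u)      = σ₁-avoids u u∉A (inj₁ (sym j≡σ₁u))
      σ₁u-unvisited (suc a , a+1<k , eq) = unvisited (a , a<k ,
        sym (σ₁-injective u _ u∉A (τ₂walk∉A a a<k) (sym eq)))
        where
        a<k : a < k
        a<k = ℕP.<-trans (ℕP.n<1+n a) a+1<k

    σ₁′∘τ₁′ : ∀ v → ¬ Src₁′ v → σ₁′ (τ₁′ v) ≡ v
    σ₁′∘τ₁′ v v∉ with visited⁻? v
    ... | yes (a , a<k , refl) =
      trans (select-yes (visited? (τ₂ (walk a))) (a , a<k , refl)) (σ₂τ₂walk a a<k)
    ... | no unvisited = trans (select-no (visited? (τ₁ v)) τ₁v-unvisited) σ₁τ₁v≡v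
      where
      σ₁τ₁v≡v : σ₁ (τ₁ v) ≡ v
      σ₁τ₁v≡v = σ₁∘τ₁ v (∉Src₁ v∉ unvisited)
      τ₁v-unvisited : ¬ Visited (τ₁ v)
      τ₁v-unvisited (a , a<k , eq) with ℕP.m≤n⇒m<n∨m≡n a<k
      ... | inj₁ a+1<k = unvisited (suc a , a+1<k , trans (cong σ₁ eq) σ₁τ₁v≡v)
      ... | inj₂ a+1≡k = v∉ (inj₁ (trans (sym (trans (cong σ₁ eq) σ₁τ₁v≡v)) (cong walk a+1≡k)))

    edge₁′-nothing : ∀ u → edge₁′ u ≡ nothing → σ₁′ u ≡ u
    edge₁′-nothing u with visited? u
    ... | yes _ = edge₂-nothing u
    ... | no _  = edge₁-nothing u

    edge₁′-just : ∀ u e → edge₁′ u ≡ just e → src e ≡ u × tgt e ≡ σ₁′ u × σ₁′ u ≢ u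
    edge₁′-just u with visited? u
    ... | yes _ = edge₂-just u
    ... | no _  = edge₁-just u

    M₁′ : Flow Src₁′ A
    M₁′ = record
      { σ = σ₁′ ; τ = τ₁′ ; edge = edge₁′
      ; σ-fixes = σ₁′-fixes ; σ-avoids = σ₁′-avoids ; τ-avoids = τ₁′-avoids
      ; τ∘σ = τ₁′∘σ₁′ ; σ∘τ = σ₁′∘τ₁′
      ; edge-nothing = edge₁′-nothing ; edge-just = edge₁′-just }

    ∉Src₂ : ∀ {v} → ¬ Src₂′ v → ¬ Visited⁺ v → ¬ Src₂ v
    ∉Src₂ {v} v∉ unvisited (v∈Q , _) with v ≟F t
    ... | yes refl = unvisited (k-1 , k-1<k , sym t≡step)
    ... | no v≢t   = v∉ (v∈Q , v≢t)

    σ₂′-fixes : ∀ u → B u → σ₂′ u ≡ u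
    σ₂′-fixes u u∈B with visited? u
    ... | yes (a , a<k , refl) = ⊥-elim (τ₂walk∉B a a<k u∈B)
    ... | no _                 = σ₂-fixes u u∈B

    σ₂′-avoids : ∀ u → ¬ B u → ¬ Src₂′ (σ₂′ u)
    σ₂′-avoids u u∉B with visited? u
    ... | no unvisited = λ (σ₂u∈Q , _) → σ₂-avoids u u∉B (σ₂u∈Q , λ σ₂u≡j →
      unvisited (0 , 0<k , σ₂-injective _ u (τ₂walk∉B 0 0<k) u∉B (trans (σ₂τ₂walk 0 0<k) (sym σ₂u≡j))))
    ... | yes (a , a<k , refl) with ℕP.m≤n⇒m<n∨m≡n a<k
    ...   | inj₁ a+1<k = λ (w∈Q , _) → moving (suc a) a+1<k (w∈Q , λ w≡j →
      ℕP.0≢1+n (walk-injective 0 (suc a) z≤n (ℕP.<⇒≤ a+1<k) (sym w≡j)))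
    ...   | inj₂ a+1≡k = λ (_ , w≢t) → w≢t (cong walk a+1≡k)

    τ₂′-avoids : ∀ v → ¬ Src₂′ v → ¬ B (τ₂′ v)
    τ₂′-avoids v v∉ with visited⁺? v
    ... | yes (a , a<k , refl) = subst (λ u → ¬ B u) (sym (τ₁walk a a<k)) (τ₂walk∉B a a<k)
    ... | no unvisited         = τ₂-avoids v (∉Src₂ v∉ unvisited)

    τ₂′∘σ₂′ : ∀ u → ¬ B u → τ₂′ (σ₂′ u) ≡ u
    τ₂′∘σ₂′ u u∉B with visited? u
    ... | yes (a , a<k , refl) =
      trans (select-yes (visited⁺? (walk (suc a))) (a , a<k , refl)) (τ₁walk a a<k)
    ... | no unvisited = trans (select-no (visited⁺? (σ₂ u)) σ₂u-unvisited) (τ₂∘σ₂ u u∉B)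
      where
      σ₂u-unvisited : ¬ Visited⁺ (σ₂ u)
      σ₂u-unvisited (a , a<k , eq) with ℕP.m≤n⇒m<n∨m≡n a<k
      ... | inj₁ a+1<k = unvisited (suc a , a+1<k ,
        σ₂-injective _ u (τ₂walk∉B (suc a) a+1<k) u∉B (trans (σ₂τ₂walk (suc a) a+1<k) eq))
      ... | inj₂ a+1≡k = σ₂-avoids u u∉B (subst Src₂ (trans (sym (cong walk a+1≡k)) eq) t∈Src₂)

    σ₂′∘τ₂′ : ∀ v → ¬ Src₂′ v → σ₂′ (τ₂′ v) ≡ v
    σ₂′∘τ₂′ v v∉ with visited⁺? v
    ... | yes (a , a<k , refl) =
      trans (cong σ₂′ (τ₁walk a a<k)) (select-yes (visited? (τ₂ (walk a))) (a , a<k , refl))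
    ... | no unvisited = trans (select-no (visited? (τ₂ v)) τ₂v-unvisited) (σ₂∘τ₂ v (∉Src₂ v∉ unvisited))
      where
      τ₂v-unvisited : ¬ Visited (τ₂ v)
      τ₂v-unvisited (a , a<k , eq) with τ₂-injective _ _ (moving a a<k) (∉Src₂ v∉ unvisited) eq
      τ₂v-unvisited (zero  , a<k   , eq) | refl = v∉ (j∈Q , λ j≡t → proj₂ t∈Src₂ (sym j≡t))
      τ₂v-unvisited (suc a , a+1<k , eq) | refl = unvisited (a , ℕP.<-trans (ℕP.n<1+n a) a+1<k , refl)

    edge₂′-nothing : ∀ u → edge₂′ u ≡ nothing → σ₂′ u ≡ u
    edge₂′-nothing u with visited? u
    ... | yes _ = edge₁-nothing u
    ... | no _  = edge₂-nothing u

    edge₂′-just : ∀ u e → edge₂′ u ≡ just e → src e ≡ u × tgt e ≡ σ₂′ u × σ₂′ u ≢ u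
    edge₂′-just u with visited? u
    ... | yes _ = edge₁-just u
    ... | no _  = edge₂-just u

    M₂′ : Flow Src₂′ B
    M₂′ = record
      { σ = σ₂′ ; τ = τ₂′ ; edge = edge₂′
      ; σ-fixes = σ₂′-fixes ; σ-avoids = σ₂′-avoids ; τ-avoids = τ₂′-avoids
      ; τ∘σ = τ₂′∘σ₂′ ; σ∘τ = σ₂′∘τ₂′
      ; edge-nothing = edge₂′-nothing ; edge-just = edge₂′-just }

    swapped : EdgesSwapped M₁ M₂ M₁′ M₂′
    swapped u with visited? u
    ... | yes _ = inj₂ (refl , refl)
    ... | no _  = inj₁ (refl , refl)

  exchange : ∀ (P Q A B : Fin m → Set) → (∀ v → Dec (Q v)) → (∀ {v} → A v → B v) →
             ∀ j → Q j → ¬ P j →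
             (M₁ : Flow (λ v → v ≡ j ⊎ P v) A) (M₂ : Flow (λ v → Q v × v ≢ j) B) →
             ∃ λ t → Q t × ¬ P t × t ≢ j ×
               Σ (Flow (λ v → v ≡ t ⊎ P v) A) λ M₁′ → Σ (Flow (λ v → Q v × v ≢ t) B) λ M₂′ →
               EdgesSwapped M₁ M₂ M₁′ M₂′
  exchange P Q A B Q? A⊆B j j∈Q j∉P M₁ M₂ =
    t , proj₁ t∈Src₂ , t∉P , proj₂ t∈Src₂ , M₁′ , M₂′ , swapped
    where open Exchange P Q A B Q? A⊆B j j∈Q j∉P M₁ M₂

module Sums {c ℓ} (G : OrderedAbelianGroup c ℓ) where
  open OrderedAbelianGroup G renaming (_≤_ to _≤G_)
  open IsAbelianGroup isAbelianGroup using (assoc; comm; identityˡ; isCommutativeMonoid)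
  open IsTotalOrder isTotalOrder using () renaming (trans to ≤G-trans)

  +-commutativeMonoid : CommutativeMonoid c c
  +-commutativeMonoid = record { isCommutativeMonoid = isCommutativeMonoid }

  open import Algebra.Properties.CommutativeMonoid.Sum +-commutativeMonoid public
    using (sum; sum-cong-≗; ∑-distrib-+; sum-replicate-zero)

  sumList : List Carrier → Carrier
  sumList = foldr _+_ 0#

  sum-zero : ∀ {n} {f : Fin n → Carrier} → (∀ u → f u ≡ 0#) → sum f ≡ 0#
  sum-zero {n} f≗0 = trans (sum-cong-≗ f≗0) (sum-replicate-zero n)

  zeroAt : ∀ {n} → Fin n → (Fin n → Carrier) → Fin n → Carrier
  zeroAt x f u = select (u ≟F x) 0# (f u)

  sum-pick : ∀ {n} (x : Fin n) (f : Fin n → Carrier) → sum f ≡ f x + sum (zeroAt x f)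
  sum-pick zero    f = cong (f zero +_) (sym (identityˡ _))
  sum-pick (suc x) f = begin
    f zero + sum (f ∘ suc)                          ≡⟨ cong (f zero +_) (sum-pick x (f ∘ suc)) ⟩
    f zero + (f (suc x) + sum (zeroAt x (f ∘ suc))) ≡⟨ sym (assoc _ _ _) ⟩
    (f zero + f (suc x)) + sum (zeroAt x (f ∘ suc)) ≡⟨ cong (_+ sum (zeroAt x (f ∘ suc))) (comm _ _) ⟩
    (f (suc x) + f zero) + sum (zeroAt x (f ∘ suc)) ≡⟨ assoc _ _ _ ⟩
    f (suc x) + (f zero + sum (zeroAt x (f ∘ suc))) ≡⟨ cong (λ z → f (suc x) + (f zero + z)) (sum-cong-≗ shift) ⟩
    f (suc x) + sum (zeroAt (suc x) f)              ∎
    where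
    open ≡-Reasoning
    shift : ∀ i → zeroAt x (f ∘ suc) i ≡ zeroAt (suc x) f (suc i)
    shift i with i ≟F x
    ... | yes refl = refl
    ... | no _     = refl

  sum-split : ∀ {n} (X : List (Fin n)) → Unique X → (g g′ : Fin n → Carrier) →
              (∀ {u} → u ∈L X → g′ u ≡ 0#) → (∀ {u} → u ∉L X → g′ u ≡ g u) →
              sum g ≡ sumList (map g X) + sum g′
  sum-split []       _            g g′ on off = trans (sum-cong-≗ (λ u → sym (off {u} λ ()))) (sym (identityˡ _))
  sum-split (x ∷ X) (x∉X ∷ uX) g g′ on off = begin
    sum g                                      ≡⟨ sum-pick x g ⟩
    g x + sum (zeroAt x g)
      ≡⟨ cong (g x +_) (sum-split X uX (zeroAt x g) g′ (on ∘ ListAny.there) off′) ⟩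
    g x + (sumList (map (zeroAt x g) X) + sum g′) ≡⟨ sym (assoc _ _ _) ⟩
    (g x + sumList (map (zeroAt x g) X)) + sum g′ ≡⟨ cong (λ z → (g x + z) + sum g′) (unchanged X x∉X) ⟩
    (g x + sumList (map g X)) + sum g′         ∎
    where
    open ≡-Reasoning
    off′ : ∀ {u} → u ∉L X → g′ u ≡ zeroAt x g u
    off′ {u} u∉X with u ≟F x
    ... | yes refl = on (ListAny.here refl)
    ... | no u≢x   = off λ { (ListAny.here u≡x) → u≢x u≡x ; (ListAny.there u∈X) → u∉X u∈X }
    unchanged : ∀ Y → All (x ≢_) Y → sumList (map (zeroAt x g) Y) ≡ sumList (map g Y)
    unchanged []      _            = refl
    unchanged (y ∷ Y) (x≢y ∷ x∉Y) = cong₂ _+_ (select-no (y ≟F x) (x≢y ∘ sym)) (unchanged Y x∉Y)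

  +-mono-≤ : ∀ {a a′ b b′} → a ≤G a′ → b ≤G b′ → a + b ≤G a′ + b′
  +-mono-≤ {a} {a′} {b} {b′} a≤a′ b≤b′ =
    ≤G-trans (+-monoˡ-≤ b a≤a′) (subst₂ _≤G_ (comm b a′) (comm b′ a′) (+-monoˡ-≤ a′ b≤b′))

  0≤a⇒b≤a+b : ∀ {a b} → 0# ≤G a → b ≤G a + b
  0≤a⇒b≤a+b {a} {b} 0≤a = subst (_≤G a + b) (identityˡ b) (+-monoˡ-≤ b 0≤a)

module FlowWeights {g ℓ} (G : OrderedAbelianGroup g ℓ) {m : ℕ} (Γ : Digraph m)
                   (w : Fin (Digraph.nE Γ) → OrderedAbelianGroup.Carrier G) where
  open OrderedAbelianGroup G hiding (_≤_)
  open IsAbelianGroup isAbelianGroup using (comm)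
  open Digraph Γ
  open Sums G

  edgeWeight : Maybe (Fin nE) → Carrier
  edgeWeight = maybe w 0#

  flowWeight : ∀ {I J} → Flow Γ I J → Carrier
  flowWeight M = sum (edgeWeight ∘ Flow.edge M)

  edgeCount : ∀ {I J} → Flow Γ I J → ℕ
  edgeCount M = sumℕ (maybe (λ _ → 1) 0 ∘ Flow.edge M)

  flowWeight-swap : ∀ {I₁ J₁ I₂ J₂ I₁′ J₁′ I₂′ J₂′}
    (M₁ : Flow Γ I₁ J₁) (M₂ : Flow Γ I₂ J₂) (M₁′ : Flow Γ I₁′ J₁′) (M₂′ : Flow Γ I₂′ J₂′) →
    EdgesSwapped Γ M₁ M₂ M₁′ M₂′ → flowWeight M₁′ + flowWeight M₂′ ≡ flowWeight M₁ + flowWeight M₂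
  flowWeight-swap M₁ M₂ M₁′ M₂′ swapped =
    trans (sym (∑-distrib-+ (weights M₁′) (weights M₂′)))
          (trans (sum-cong-≗ pointwise) (∑-distrib-+ (weights M₁) (weights M₂)))
    where
    weights : ∀ {I J} → Flow Γ I J → Fin m → Carrier
    weights M = edgeWeight ∘ Flow.edge M
    pointwise : ∀ u → weights M₁′ u + weights M₂′ u ≡ weights M₁ u + weights M₂ u
    pointwise u with swapped u
    ... | inj₁ (e₁ , e₂) = cong₂ _+_ (cong edgeWeight e₁) (cong edgeWeight e₂)
    ... | inj₂ (e₁ , e₂) = trans (cong₂ _+_ (cong edgeWeight e₁) (cong edgeWeight e₂)) (comm _ _)

  module Chains {I J} (M : Flow Γ I J) where
    open Flow M

    weight : Fin m → Carrier
    weight = edgeWeight ∘ edge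

    movedEdge : ∀ u → σ u ≢ u → ∃ λ e → edge u ≡ just e
    movedEdge u moved with edge u in eq
    ... | just e  = e , refl
    ... | nothing = ⊥-elim (moved (edge-nothing u eq))

    module _ {u} (moved : σ u ≢ u) where
      private
        e : Fin nE
        e = proj₁ (movedEdge u moved)

      movedEdge-src : src e ≡ u
      movedEdge-src = proj₁ (edge-just u e (proj₂ (movedEdge u moved)))

      movedEdge-tgt : tgt e ≡ σ u
      movedEdge-tgt = proj₁ (proj₂ (edge-just u e (proj₂ (movedEdge u moved))))

      movedEdge-weight : weight u ≡ w e
      movedEdge-weight = cong edgeWeight (proj₂ (movedEdge u moved))

    Stepping : (ℕ → Fin m) → ℕ → Set
    Stepping f n = ∀ a → a < n → σ (f a) ≡ f (suc a) × σ (f a) ≢ f a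

    private
      stepping-tail : ∀ {f n} → Stepping f (suc n) → Stepping (f ∘ suc) n
      stepping-tail st a a<n = st (suc a) (s≤s a<n)

    chainEdges : ∀ f n → Stepping f n → List (Fin nE)
    chainEdges f zero    _  = []
    chainEdges f (suc n) st = proj₁ (movedEdge (f 0) (proj₂ (st 0 z<s))) ∷ chainEdges (f ∘ suc) n (stepping-tail st)

    private
      chainEdges-tgt₀ : ∀ f n (st : Stepping f (suc n)) → tgt (proj₁ (movedEdge (f 0) (proj₂ (st 0 z<s)))) ≡ f 1
      chainEdges-tgt₀ f n st = trans (movedEdge-tgt (proj₂ (st 0 z<s))) (proj₁ (st 0 z<s))

    chainEdges-walk : ∀ f n st → IsWalkFrom Γ (f 0) (chainEdges f n st)
    chainEdges-walk f zero    st = tt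
    chainEdges-walk f (suc n) st = movedEdge-src (proj₂ (st 0 z<s)) ,
      subst (λ v → IsWalkFrom Γ v (chainEdges (f ∘ suc) n (stepping-tail st)))
            (sym (chainEdges-tgt₀ f n st)) (chainEdges-walk (f ∘ suc) n (stepping-tail st))

    chainEdges-end : ∀ f n st → walkEnd Γ (f 0) (chainEdges f n st) ≡ f n
    chainEdges-end f zero    st = refl
    chainEdges-end f (suc n) st =
      trans (cong (λ v → walkEnd Γ v (chainEdges (f ∘ suc) n (stepping-tail st))) (chainEdges-tgt₀ f n st))
            (chainEdges-end (f ∘ suc) n (stepping-tail st))

    chainEdges-tgts : ∀ f n st → map tgt (chainEdges f n st) ≡ applyUpTo (f ∘ suc) n
    chainEdges-tgts f zero    st = refl
    chainEdges-tgts f (suc n) st = cong₂ _∷_ (chainEdges-tgt₀ f n st) (chainEdges-tgts (f ∘ suc) n (stepping-tail st))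

    chainEdges-weight : ∀ f n st → edgesWeight G Γ w (chainEdges f n st) ≡ sumList (map weight (applyUpTo f n))
    chainEdges-weight f zero    st = refl
    chainEdges-weight f (suc n) st =
      cong₂ _+_ (sym (movedEdge-weight (proj₂ (st 0 z<s)))) (chainEdges-weight (f ∘ suc) n (stepping-tail st))

-- From flows to linkings

module FlowsToLinkings {g ℓ} (G : OrderedAbelianGroup g ℓ) {m : ℕ} (Γ : Digraph m)
                   (w : Fin (Digraph.nE Γ) → OrderedAbelianGroup.Carrier G) where
  open OrderedAbelianGroup G renaming (_≤_ to _≤G_)
  open IsTotalOrder isTotalOrder using () renaming (refl to ≤G-refl; reflexive to ≤G-reflexive; trans to ≤G-trans)
  open Digraph Γ
  open Sums G
  open FlowWeights G Γ w

  module CycleRemoval {I J} (M : Flow Γ I J) (no-sources : ∀ v → ¬ I v)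
                      {u₀ e₀} (edge-u₀ : Flow.edge M u₀ ≡ just e₀) where
    open Flow M
    open Chains M
    open Orbit τ u₀ using () renaming (orbit to back)
    open Orbit σ u₀ using () renaming (orbit to z)

    u₀-moved : σ u₀ ≢ u₀
    u₀-moved = proj₂ (proj₂ (edge-just u₀ e₀ edge-u₀))

    -- Without sources τ is injective on all of V, so u₀ lies on a τ-cycle, and σ runs it backwards.
    opaque
      back-returns : ∃ λ L → back (suc L) ≡ u₀
      back-returns = Orbit.orbit-returns τ u₀ (λ x y _ _ → τ-injective x y (no-sources x) (no-sources y))

    L : ℕ
    L = proj₁ back-returns

    σ-undoes-back : ∀ b r → fold (back (b ℕ.+ r)) σ b ≡ back r
    σ-undoes-back zero    r = refl
    σ-undoes-back (suc b) r = begin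
      fold (back (suc b ℕ.+ r)) σ (suc b) ≡⟨ fold-suc-inner _ σ b ⟩
      fold (σ (back (suc b ℕ.+ r))) σ b   ≡⟨ cong (λ v → fold v σ b) (σ∘τ (back (b ℕ.+ r)) (no-sources _)) ⟩
      fold (back (b ℕ.+ r)) σ b           ≡⟨ σ-undoes-back b r ⟩
      back r                              ∎
      where open ≡-Reasoning

    u₀≡back : ∀ b r → b ℕ.+ r ≡ suc L → u₀ ≡ back (b ℕ.+ r)
    u₀≡back b r b+r≡1+L = trans (sym (proj₂ back-returns)) (cong back (sym b+r≡1+L))

    z-returns : z (suc L) ≡ u₀
    z-returns = trans (cong (λ v → fold v σ (suc L)) (u₀≡back (suc L) 0 (ℕP.+-identityʳ (suc L))))
                      (σ-undoes-back (suc L) 0)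

    z∉J : ∀ b → b ≤ L → ¬ J (z b)
    z∉J b b≤L with ℕP.m≤n⇒∃[o]m+o≡n b≤L
    ... | o , b+o≡L = subst (λ v → ¬ J v) back≡z (τ-avoids (back o) (no-sources _))
      where
      back≡z : back (suc o) ≡ z b
      back≡z = trans (sym (σ-undoes-back b (suc o)))
                     (cong (λ v → fold v σ b) (sym (u₀≡back b (suc o) (trans (ℕP.+-suc b o) (cong suc b+o≡L)))))

    opaque
      period : ∃ λ c → z (suc c) ≡ u₀ × c ≤ L × Orbit.InjectiveUpTo σ u₀ c
      period = Orbit.orbit-period σ u₀ σ-injective L z-returns z∉J

    c : ℕ
    c = proj₁ period

    z-period : z (suc c) ≡ u₀
    z-period = proj₁ (proj₂ period)

    c≤L : c ≤ L
    c≤L = proj₁ (proj₂ (proj₂ period))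

    z-injective : Orbit.InjectiveUpTo σ u₀ c
    z-injective = proj₂ (proj₂ (proj₂ period))

    z-moved : ∀ a → a < suc c → σ (z a) ≢ z a
    z-moved a a<1+c eq with ℕP.m≤n⇒m<n∨m≡n (s≤s⁻¹ a<1+c)
    ... | inj₁ a<c  = ℕP.1+n≢n (z-injective (suc a) a a<c (ℕP.<⇒≤ a<c) eq)
    ... | inj₂ refl = u₀-moved (subst (λ a → z (suc a) ≡ u₀) c≡0 z-period)
      where
      c≡0 : c ≡ 0
      c≡0 = sym (z-injective 0 c z≤n ℕP.≤-refl (trans (sym z-period) eq))

    stepping : Stepping z (suc c)
    stepping a a<1+c = refl , z-moved a a<1+c

    cycleEdges : List (Fin nE)
    cycleEdges = chainEdges z (suc c) stepping

    rotated-unique : Unique (applyUpTo (z ∘ suc) (suc c))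
    rotated-unique = Uniqueₚ.applyUpTo⁺₁ (z ∘ suc) (suc c) distinct
      where
      distinct : ∀ {i j} → i < j → j < suc c → z (suc i) ≢ z (suc j)
      distinct {i} {j} i<j j<1+c eq with ℕP.m≤n⇒m<n∨m≡n (s≤s⁻¹ j<1+c)
      ... | inj₁ j<c  = ℕP.<⇒≢ i<j (ℕP.suc-injective
                          (z-injective (suc i) (suc j) (ℕP.<-trans i<j j<c) j<c eq))
      ... | inj₂ refl = ℕP.0≢1+n (z-injective 0 (suc i) z≤n i<j (trans (sym z-period) (sym eq)))

    cycle : Cycle Γ
    cycle = record
      { start    = u₀
      ; edges    = cycleEdges
      ; nonempty = λ ()
      ; walk     = chainEdges-walk z (suc c) stepping
      ; closed   = trans (chainEdges-end z (suc c) stepping) z-period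
      ; simple   = subst Unique (sym (chainEdges-tgts z (suc c) stepping)) rotated-unique }

    cycleWeight : Carrier
    cycleWeight = sumList (map weight (applyUpTo z (suc c)))

    cycleWeight-nonneg : NoNegativeCycle G Γ w → 0# ≤G cycleWeight
    cycleWeight-nonneg noNeg = subst (0# ≤G_) (chainEdges-weight z (suc c) stepping) (noNeg cycle)

    OnCycle : Fin m → Set
    OnCycle u = ∃ λ a → a < suc c × z a ≡ u

    onCycle? : ∀ u → Dec (OnCycle u)
    onCycle? u = ℕP.anyUpTo? (λ a → z a ≟F u) (suc c)

    σ′ τ′ : Fin m → Fin m
    σ′ u = select (onCycle? u) u (σ u)
    τ′ v = select (onCycle? v) v (τ v)

    edge′ : Fin m → Maybe (Fin nE)
    edge′ u = select (onCycle? u) nothing (edge u)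

    σ′-fixes : ∀ u → J u → σ′ u ≡ u
    σ′-fixes u u∈J with onCycle? u
    ... | yes _ = refl
    ... | no _  = σ-fixes u u∈J

    τ′-avoids : ∀ v → ¬ I v → ¬ J (τ′ v)
    τ′-avoids v v∉I with onCycle? v
    ... | yes (a , a<1+c , refl) = z∉J a (ℕP.≤-trans (s≤s⁻¹ a<1+c) c≤L)
    ... | no _                   = τ-avoids v v∉I

    τ′∘σ′ : ∀ u → ¬ J u → τ′ (σ′ u) ≡ u
    τ′∘σ′ u u∉J with onCycle? u
    ... | yes on  = select-yes (onCycle? u) on
    ... | no off = trans (select-no (onCycle? (σ u)) σu-off) (τ∘σ u u∉J)
      where
      σu-off : ¬ OnCycle (σ u)
      σu-off (zero , _ , u₀≡σu) = off (c , ℕP.≤-refl ,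
        sym (σ-injective u (z c) u∉J (z∉J c c≤L) (trans (sym u₀≡σu) (sym z-period))))
      σu-off (suc a , a+1<1+c , eq) = off (a , ℕP.<-trans (ℕP.n<1+n a) a+1<1+c ,
        sym (σ-injective u (z a) u∉J (z∉J a (ℕP.≤-trans (ℕP.<⇒≤ (s≤s⁻¹ a+1<1+c)) c≤L)) (sym eq)))

    σ′∘τ′ : ∀ v → ¬ I v → σ′ (τ′ v) ≡ v
    σ′∘τ′ v v∉I with onCycle? v
    ... | yes on  = select-yes (onCycle? v) on
    ... | no off = trans (select-no (onCycle? (τ v)) τv-off) (σ∘τ v v∉I)
      where
      τv-off : ¬ OnCycle (τ v)
      τv-off (a , a<1+c , eq) with ℕP.m≤n⇒m<n∨m≡n (s≤s⁻¹ a<1+c)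
      ... | inj₁ a<c  = off (suc a , s≤s a<c , trans (cong σ eq) (σ∘τ v v∉I))
      ... | inj₂ refl = off (0 , z<s , trans (sym z-period) (trans (cong σ eq) (σ∘τ v v∉I)))

    edge′-nothing : ∀ u → edge′ u ≡ nothing → σ′ u ≡ u
    edge′-nothing u with onCycle? u
    ... | yes _ = λ _ → refl
    ... | no _  = edge-nothing u

    edge′-just : ∀ u e → edge′ u ≡ just e → src e ≡ u × tgt e ≡ σ′ u × σ′ u ≢ u
    edge′-just u e with onCycle? u
    ... | yes _ = λ ()
    ... | no _  = edge-just u e

    M′ : Flow Γ I J
    M′ = record
      { σ = σ′ ; τ = τ′ ; edge = edge′
      ; σ-fixes = σ′-fixes ; σ-avoids = λ _ _ → no-sources _ ; τ-avoids = τ′-avoids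
      ; τ∘σ = τ′∘σ′ ; σ∘τ = σ′∘τ′
      ; edge-nothing = edge′-nothing ; edge-just = edge′-just }

    flowWeight-split : flowWeight M ≡ cycleWeight + flowWeight M′
    flowWeight-split = sum-split (applyUpTo z (suc c)) (Orbit.orbit-segment-unique σ u₀ z-injective ℕP.≤-refl)
                                 weight (edgeWeight ∘ edge′) on off
      where
      on : ∀ {u} → u ∈L applyUpTo z (suc c) → edgeWeight (edge′ u) ≡ 0#
      on {u} u∈ with ∈-applyUpTo⁻ z u∈
      ... | a , a<1+c , refl = cong edgeWeight (select-yes (onCycle? u) (a , a<1+c , refl))
      off : ∀ {u} → u ∉L applyUpTo z (suc c) → edgeWeight (edge′ u) ≡ weight u
      off {u} u∉ = cong edgeWeight (select-no (onCycle? u) λ { (a , a<1+c , refl) → u∉ (∈-applyUpTo⁺ z a<1+c) })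

    edgeCount-decreases : edgeCount M′ < edgeCount M
    edgeCount-decreases = sumℕ-mono-< _ _ pointwise u₀ at-u₀
      where
      count : Maybe (Fin nE) → ℕ
      count = maybe (λ _ → 1) 0
      pointwise : ∀ u → count (edge′ u) ≤ count (edge u)
      pointwise u with onCycle? u
      ... | yes _ = z≤n
      ... | no _  = ℕP.≤-refl
      at-u₀ : count (edge′ u₀) < count (edge u₀)
      at-u₀ = subst₂ (λ a b → count a < count b)
                     (sym (select-yes (onCycle? u₀) (0 , z<s , refl))) (sym edge-u₀) (s≤s z≤n)

  flowWeight-nonneg : NoNegativeCycle G Γ w → ∀ {I J} (M : Flow Γ I J) → (∀ v → ¬ I v) → 0# ≤G flowWeight M
  flowWeight-nonneg noNeg {I} {J} M no-sources = bounded (edgeCount M) M ℕP.≤-refl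
    where
    bounded : ∀ N (M : Flow Γ I J) → edgeCount M ≤ N → 0# ≤G flowWeight M
    bounded N M count≤N with hasEdge? Γ M
    ... | inj₁ none                   = ≤G-reflexive (sym (sum-zero (cong edgeWeight ∘ none)))
    ... | inj₂ (u₀ , e₀ , edge-u₀) = remove N count≤N
      where
      open CycleRemoval M no-sources edge-u₀
      remove : ∀ N → edgeCount M ≤ N → 0# ≤G flowWeight M
      remove zero    count≤0   = ⊥-elim (ℕP.n≮0 (ℕP.<-≤-trans edgeCount-decreases count≤0))
      remove (suc N) count≤1+N = subst (0# ≤G_) (sym flowWeight-split)
        (≤G-trans (bounded N M′ (s≤s⁻¹ (ℕP.<-≤-trans edgeCount-decreases count≤1+N)))
                  (0≤a⇒b≤a+b (cycleWeight-nonneg noNeg)))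

  Active : ∀ {I J} → Flow Γ I J → Fin m → Set
  Active {I} {J} M u = I u ⊎ J u ⊎ Flow.σ M u ≢ u

  -- Follow σ from a source s until it hits J, and split this path off.
  module PathRemoval (I J : Subset m) (M : Flow Γ (_∈ I) (_∈ J)) (s : Fin m) (s∈I : s ∈ I) where
    open Flow M
    open Chains M
    open Orbit σ s using () renaming (orbit to x; InjectiveUpTo to PathInjectiveUpTo)

    s-unreached : ∀ v → v ∉ J → σ v ≢ s
    s-unreached v v∉J σv≡s = σ-avoids v v∉J (subst (_∈ I) (sym σv≡s) s∈I)

    opaque
      stops : ∃ λ k → x k ∈ J × (∀ a → a < k → x a ∉ J) × PathInjectiveUpTo k
      stops = Orbit.orbit-stops σ s (_∈ J) (_∈? J) σ-injective s-unreached

    k : ℕ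
    k = proj₁ stops

    x-end∈J : x k ∈ J
    x-end∈J = proj₁ (proj₂ stops)

    moving : ∀ a → a < k → x a ∉ J
    moving = proj₁ (proj₂ (proj₂ stops))

    x-injective : PathInjectiveUpTo k
    x-injective = proj₂ (proj₂ (proj₂ stops))

    stepping : Stepping x k
    stepping a a<k = refl , λ eq → ℕP.1+n≢n (x-injective (suc a) a a<k (ℕP.<⇒≤ a<k) eq)

    pathEdges : List (Fin nE)
    pathEdges = chainEdges x k stepping

    path : Path Γ
    path = record
      { start  = s
      ; edges  = pathEdges
      ; walk   = chainEdges-walk x k stepping
      ; simple = subst Unique (cong (s ∷_) (sym (chainEdges-tgts x k stepping)))
                       (Orbit.orbit-segment-unique σ s x-injective ℕP.≤-refl) }

    path-end : pathEnd Γ path ≡ x k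
    path-end = chainEdges-end x k stepping

    path-vertices : pathVertices Γ path ≡ applyUpTo x (suc k)
    path-vertices = cong (s ∷_) (chainEdges-tgts x k stepping)

    OnPath : Fin m → Set
    OnPath u = ∃ λ a → a < suc k × x a ≡ u

    onPath? : ∀ u → Dec (OnPath u)
    onPath? u = ℕP.anyUpTo? (λ a → x a ≟F u) (suc k)

    σ′ τ′ : Fin m → Fin m
    σ′ u = select (onPath? u) u (σ u)
    τ′ v = select (onPath? v) v (τ v)

    edge′ : Fin m → Maybe (Fin nE)
    edge′ u = select (onPath? u) nothing (edge u)

    I′ J′ : Subset m
    I′ = I - s
    J′ = J - x k

    x∉I′ : ∀ a → a < suc k → x a ∉ I′
    x∉I′ zero    _       x∈ = proj₂ (x∈p-y⇒x∈p×x≢y I s x∈) refl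
    x∉I′ (suc a) a+1<1+k x∈ = σ-avoids (x a) (moving a (s≤s⁻¹ a+1<1+k)) (proj₁ (x∈p-y⇒x∈p×x≢y I s x∈))

    x∉J′ : ∀ a → a < suc k → x a ∉ J′
    x∉J′ a a<1+k x∈ with ℕP.m≤n⇒m<n∨m≡n (s≤s⁻¹ a<1+k)
    ... | inj₁ a<k  = moving a a<k (proj₁ (x∈p-y⇒x∈p×x≢y J (x k) x∈))
    ... | inj₂ refl = proj₂ (x∈p-y⇒x∈p×x≢y J (x k) x∈) refl

    off⇒∉J : ∀ {u} → ¬ OnPath u → u ∉ J′ → u ∉ J
    off⇒∉J off u∉J′ u∈J = u∉J′ (x∈p∧x≢y⇒x∈p-y u∈J λ u≡ → off (k , ℕP.≤-refl , sym u≡))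

    off⇒∉I : ∀ {v} → ¬ OnPath v → v ∉ I′ → v ∉ I
    off⇒∉I off v∉I′ v∈I = v∉I′ (x∈p∧x≢y⇒x∈p-y v∈I λ v≡ → off (0 , z<s , sym v≡))

    σ′-fixes : ∀ u → u ∈ J′ → σ′ u ≡ u
    σ′-fixes u u∈J′ with onPath? u
    ... | yes _ = refl
    ... | no _  = σ-fixes u (proj₁ (x∈p-y⇒x∈p×x≢y J (x k) u∈J′))

    σ′-avoids : ∀ u → u ∉ J′ → σ′ u ∉ I′
    σ′-avoids u u∉J′ with onPath? u
    ... | yes (a , a<1+k , refl) = x∉I′ a a<1+k
    ... | no off = σ-avoids u (off⇒∉J off u∉J′) ∘ proj₁ ∘ x∈p-y⇒x∈p×x≢y I s

    τ′-avoids : ∀ v → v ∉ I′ → τ′ v ∉ J′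
    τ′-avoids v v∉I′ with onPath? v
    ... | yes (a , a<1+k , refl) = x∉J′ a a<1+k
    ... | no off = τ-avoids v (off⇒∉I off v∉I′) ∘ proj₁ ∘ x∈p-y⇒x∈p×x≢y J (x k)

    τ′∘σ′ : ∀ u → u ∉ J′ → τ′ (σ′ u) ≡ u
    τ′∘σ′ u u∉J′ with onPath? u
    ... | yes on = select-yes (onPath? u) on
    ... | no off = trans (select-no (onPath? (σ u)) σu-off) (τ∘σ u u∉J)
      where
      u∉J : u ∉ J
      u∉J = off⇒∉J off u∉J′
      σu-off : ¬ OnPath (σ u)
      σu-off (zero  , _       , s≡σu) = σ-avoids u u∉J (subst (_∈ I) s≡σu s∈I)
      σu-off (suc a , a+1<1+k , eq)   = off (a , ℕP.<-trans (ℕP.n<1+n a) a+1<1+k ,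
        sym (σ-injective u (x a) u∉J (moving a (s≤s⁻¹ a+1<1+k)) (sym eq)))

    σ′∘τ′ : ∀ v → v ∉ I′ → σ′ (τ′ v) ≡ v
    σ′∘τ′ v v∉I′ with onPath? v
    ... | yes on = select-yes (onPath? v) on
    ... | no off = trans (select-no (onPath? (τ v)) τv-off) (σ∘τ v v∉I)
      where
      v∉I : v ∉ I
      v∉I = off⇒∉I off v∉I′
      τv-off : ¬ OnPath (τ v)
      τv-off (a , a<1+k , eq) with ℕP.m≤n⇒m<n∨m≡n (s≤s⁻¹ a<1+k)
      ... | inj₁ a<k  = off (suc a , s≤s a<k , trans (cong σ eq) (σ∘τ v v∉I))
      ... | inj₂ refl = τ-avoids v v∉I (subst (_∈ J) eq x-end∈J)

    edge′-nothing : ∀ u → edge′ u ≡ nothing → σ′ u ≡ u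
    edge′-nothing u with onPath? u
    ... | yes _ = λ _ → refl
    ... | no _  = edge-nothing u

    edge′-just : ∀ u e → edge′ u ≡ just e → src e ≡ u × tgt e ≡ σ′ u × σ′ u ≢ u
    edge′-just u e with onPath? u
    ... | yes _ = λ ()
    ... | no _  = edge-just u e

    M′ : Flow Γ (_∈ I′) (_∈ J′)
    M′ = record
      { σ = σ′ ; τ = τ′ ; edge = edge′
      ; σ-fixes = σ′-fixes ; σ-avoids = σ′-avoids ; τ-avoids = τ′-avoids
      ; τ∘σ = τ′∘σ′ ; σ∘τ = σ′∘τ′
      ; edge-nothing = edge′-nothing ; edge-just = edge′-just }

    end-weight : weight (x k) ≡ 0#
    end-weight with edge (x k) in eq
    ... | nothing = refl
    ... | just e  = ⊥-elim (proj₂ (proj₂ (edge-just (x k) e eq)) (σ-fixes (x k) x-end∈J))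

    flowWeight-split : flowWeight M ≡ edgesWeight G Γ w pathEdges + flowWeight M′
    flowWeight-split = trans
      (sum-split (applyUpTo x k) (Orbit.orbit-segment-unique σ s x-injective (ℕP.n≤1+n k))
                 weight (edgeWeight ∘ edge′) on off)
      (cong (_+ flowWeight M′) (sym (chainEdges-weight x k stepping)))
      where
      on : ∀ {u} → u ∈L applyUpTo x k → edgeWeight (edge′ u) ≡ 0#
      on {u} u∈ with ∈-applyUpTo⁻ x u∈
      ... | a , a<k , refl = cong edgeWeight (select-yes (onPath? u) (a , ℕP.m≤n⇒m≤1+n a<k , refl))
      off : ∀ {u} → u ∉L applyUpTo x k → edgeWeight (edge′ u) ≡ weight u
      off {u} u∉ with onPath? u
      ... | no _ = refl
      ... | yes (a , a<1+k , refl) with ℕP.m≤n⇒m<n∨m≡n (s≤s⁻¹ a<1+k)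
      ...   | inj₁ a<k  = ⊥-elim (u∉ (∈-applyUpTo⁺ x a<k))
      ...   | inj₂ refl = sym end-weight

    path-inactive′ : ∀ {v} → v ∈L pathVertices Γ path → ¬ Active M′ v
    path-inactive′ {v} v∈ with ∈-applyUpTo⁻ x (subst (v ∈L_) path-vertices v∈)
    ... | a , a<1+k , refl = λ
      { (inj₁ x∈I′)          → x∉I′ a a<1+k x∈I′
      ; (inj₂ (inj₁ x∈J′))   → x∉J′ a a<1+k x∈J′
      ; (inj₂ (inj₂ moved)) → moved (select-yes (onPath? (x a)) (a , a<1+k , refl)) }

    active′⇒active : ∀ {v} → Active M′ v → Active M v
    active′⇒active (inj₁ v∈I′)        = inj₁ (proj₁ (x∈p-y⇒x∈p×x≢y I s v∈I′))
    active′⇒active (inj₂ (inj₁ v∈J′)) = inj₂ (inj₁ (proj₁ (x∈p-y⇒x∈p×x≢y J (x k) v∈J′)))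
    active′⇒active {v} (inj₂ (inj₂ moved)) with onPath? v
    ... | yes _ = ⊥-elim (moved refl)
    ... | no _  = inj₂ (inj₂ moved)

    path-active : All (Active M) (pathVertices Γ path)
    path-active = subst (All (Active M)) (sym path-vertices) (Allₚ.applyUpTo⁺₁ x (suc k) active)
      where
      active : ∀ {a} → a < suc k → Active M (x a)
      active {a} a<1+k with ℕP.m≤n⇒m<n∨m≡n (s≤s⁻¹ a<1+k)
      ... | inj₁ a<k  = inj₂ (inj₂ (proj₂ (stepping a a<k)))
      ... | inj₂ refl = inj₂ (inj₁ x-end∈J)

  record LinkingInside {I J : Subset m} (M : Flow Γ (_∈ I) (_∈ J)) : Set (g ⊔ ℓ) where
    field
      linking : Linking Γ I J
      weight≤ : linkingWeight G Γ w linking ≤G flowWeight M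
      active  : All (All (Active M) ∘ pathVertices Γ) (Linking.paths linking)

  flow⇒linking : NoNegativeCycle G Γ w → ∀ {I J : Subset m} (M : Flow Γ (_∈ I) (_∈ J)) → LinkingInside M
  flow⇒linking noNeg {I} {J} M = extract ∣ I ∣ I J refl M
    where
    extract : ∀ n (I J : Subset m) → ∣ I ∣ ≡ n → (M : Flow Γ (_∈ I) (_∈ J)) → LinkingInside M
    extract zero I J ∣I∣≡0 M = record
      { linking = record { paths = [] ; count = sym ∣I∣≡0 ; disjoint = [] ; starts = [] ; ends = [] }
      ; weight≤ = flowWeight-nonneg noNeg M (∣p∣≡0⇒x∉p I ∣I∣≡0)
      ; active  = [] }
    extract (suc n) I J ∣I∣≡1+n M with ∣p∣≡1+k⇒Nonempty I ∣I∣≡1+n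
    ... | s , s∈I = record
      { linking = record
        { paths    = path ∷ Linking.paths L′
        ; count    = trans (cong suc (Linking.count L′)) (x∈p⇒∣p-x∣+1≡∣p∣ I s∈I)
        ; disjoint = All.map (λ active′ {v} v∈path v∈q → path-inactive′ v∈path (All.lookup active′ v∈q))
                             (LinkingInside.active rest)
                     ∷ Linking.disjoint L′
        ; starts   = s∈I ∷ All.map (proj₁ ∘ x∈p-y⇒x∈p×x≢y I s) (Linking.starts L′)
        ; ends     = subst (_∈ J) (sym path-end) x-end∈J
                     ∷ All.map (proj₁ ∘ x∈p-y⇒x∈p×x≢y J _) (Linking.ends L′) }
      ; weight≤ = subst (edgesWeight G Γ w pathEdges + linkingWeight G Γ w L′ ≤G_) (sym flowWeight-split)
                        (+-mono-≤ ≤G-refl (LinkingInside.weight≤ rest))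
      ; active  = path-active ∷ All.map (All.map active′⇒active) (LinkingInside.active rest) }
      where
      open PathRemoval I J M s s∈I
      rest : LinkingInside M′
      rest = extract n I′ J′ (ℕP.suc-injective (trans (x∈p⇒∣p-x∣+1≡∣p∣ I s∈I) ∣I∣≡1+n)) M′
      L′ : Linking Γ I′ J′
      L′ = LinkingInside.linking rest

-- From linkings to flows

module LinkingsToFlows {g ℓ} (G : OrderedAbelianGroup g ℓ) {m : ℕ} (Γ : Digraph m)
                   (w : Fin (Digraph.nE Γ) → OrderedAbelianGroup.Carrier G) where
  open OrderedAbelianGroup G hiding (_≤_)
  open IsAbelianGroup isAbelianGroup using (assoc; identityˡ)
  open Digraph Γ
  open Sums G
  open FlowWeights G Γ w
  open Walks Γ

  outEdge inEdge : List (Fin nE) → Fin m → Maybe (Fin nE)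
  outEdge es u = List.find (λ e → src e ≟F u) es
  inEdge  es v = List.find (λ e → tgt e ≟F v) es

  sum-outEdge : ∀ es → Unique (map src es) → sum (edgeWeight ∘ outEdge es) ≡ edgesWeight G Γ w es
  sum-outEdge []       _               = sum-zero {m} (λ _ → refl)
  sum-outEdge (e ∷ es) (e-fresh ∷ uniq) = begin
    sum f                                ≡⟨ sum-pick (src e) f ⟩
    f (src e) + sum (zeroAt (src e) f)   ≡⟨ cong₂ _+_ f-src (sum-cong-≗ rest) ⟩
    w e + sum (edgeWeight ∘ outEdge es)  ≡⟨ cong (w e +_) (sum-outEdge es uniq) ⟩
    w e + edgesWeight G Γ w es           ∎
    where
    open ≡-Reasoning
    f : Fin m → Carrier
    f = edgeWeight ∘ outEdge (e ∷ es)
    f-src : f (src e) ≡ w e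
    f-src with src e ≟F src e
    ... | yes _    = refl
    ... | no e≢e = ⊥-elim (e≢e refl)
    no-other : outEdge es (src e) ≡ nothing
    no-other with outEdge es (src e) in eq
    ... | nothing = refl
    ... | just e′ with find-just (λ e′ → src e′ ≟F src e) es eq
    ...   | e′∈ , src≡ = ⊥-elim (All.lookup e-fresh (∈-map⁺ src e′∈) (sym src≡))
    rest : ∀ u → zeroAt (src e) f u ≡ edgeWeight (outEdge es u)
    rest u with u ≟F src e
    ... | yes refl = sym (cong edgeWeight no-other)
    ... | no u≢src with src e ≟F u
    ...   | yes src≡u = ⊥-elim (u≢src (sym src≡u))
    ...   | no _      = refl

  edgesWeight-++ : ∀ xs ys → edgesWeight G Γ w (xs List.++ ys) ≡ edgesWeight G Γ w xs + edgesWeight G Γ w ys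
  edgesWeight-++ []       ys = sym (identityˡ _)
  edgesWeight-++ (x ∷ xs) ys = trans (cong (w x +_) (edgesWeight-++ xs ys)) (sym (assoc _ _ _))

  -- The edges of a linking onto J with ∣ I ∣ = ∣ J ∣ give a flow from I to J: σ follows the unique
  -- edge leaving a vertex, τ the unique edge entering it.
  module LinkingFlow (I J : Subset m) (L : Linking Γ I J) (∣I∣≡∣J∣ : ∣ I ∣ ≡ ∣ J ∣) where
    open Linking L

    allEdges : List (Path Γ) → List (Fin nE)
    allEdges = foldr (λ p es → Path.edges p List.++ es) []

    edges : List (Fin nE)
    edges = allEdges paths

    ∈-allEdges⁻ : ∀ ps {e} → e ∈L allEdges ps → ∃ λ p → p ∈L ps × e ∈L Path.edges p
    ∈-allEdges⁻ (p ∷ ps) e∈ with ∈-++⁻ (Path.edges p) e∈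
    ... | inj₁ e∈p  = p , ListAny.here refl , e∈p
    ... | inj₂ e∈ps = Data.Product.map₂ (Data.Product.map₁ ListAny.there) (∈-allEdges⁻ ps e∈ps)

    ∈-allEdges⁺ : ∀ ps {p e} → p ∈L ps → e ∈L Path.edges p → e ∈L allEdges ps
    ∈-allEdges⁺ (q ∷ ps) (ListAny.here refl) e∈ = ∈-++⁺ˡ e∈
    ∈-allEdges⁺ (q ∷ ps) (ListAny.there p∈) e∈ = ∈-++⁺ʳ (Path.edges q) (∈-allEdges⁺ ps p∈ e∈)

    Disjoint′ : Path Γ → Path Γ → Set
    Disjoint′ p q = Disjoint Γ (pathVertices Γ p) (pathVertices Γ q)

    samePath : ∀ {ps} → AllPairs Disjoint′ ps → ∀ {p q v} → p ∈L ps → q ∈L ps →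
               v ∈L pathVertices Γ p → v ∈L pathVertices Γ q → p ≡ q
    samePath _           (ListAny.here refl) (ListAny.here refl) _   _   = refl
    samePath (p∉ ∷ _)    (ListAny.here refl) (ListAny.there q∈)  v∈p v∈q = ⊥-elim (All.lookup p∉ q∈ v∈p v∈q)
    samePath (q∉ ∷ _)    (ListAny.there p∈)  (ListAny.here refl) v∈p v∈q = ⊥-elim (All.lookup q∉ p∈ v∈q v∈p)
    samePath (_ ∷ disj) (ListAny.there p∈)  (ListAny.there q∈)  v∈p v∈q = samePath disj p∈ q∈ v∈p v∈q

    allEdges-unique : ∀ (f : Fin nE → Fin m) → (∀ p {e} → e ∈L Path.edges p → f e ∈L pathVertices Γ p) →
                      (∀ p → Unique (map f (Path.edges p))) →
                      ∀ {ps} → AllPairs Disjoint′ ps → Unique (map f (allEdges ps))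
    allEdges-unique f f∈ f-unique []               = []
    allEdges-unique f f∈ f-unique {p ∷ ps} (p∉ ∷ disj) =
      subst Unique (sym (map-++ f (Path.edges p) (allEdges ps)))
            (Uniqueₚ.++⁺ (f-unique p) (allEdges-unique f f∈ f-unique disj) apart)
      where
      apart : ∀ {v} → v ∈L map f (Path.edges p) × v ∈L map f (allEdges ps) → ⊥
      apart (v∈p , v∈ps) with ∈-map⁻ f v∈p | ∈-map⁻ f v∈ps
      ... | e , e∈ , refl | e′ , e′∈ , eq with ∈-allEdges⁻ ps e′∈
      ...   | q , q∈ , e′∈q = All.lookup p∉ q∈ (f∈ p e∈) (subst (_∈L pathVertices Γ q) (sym eq) (f∈ q e′∈q))

    srcs-unique : Unique (map src edges)
    srcs-unique = allEdges-unique src (λ p → ∈-walk-src _ _ (Path.walk p))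
                    (λ p → walk-srcs-unique _ _ (Path.walk p) (Path.simple p)) disjoint

    tgts-unique : Unique (map tgt edges)
    tgts-unique = allEdges-unique tgt (λ p → ∈-walk-tgt _ _) (λ p → AllPairs.tail (Path.simple p)) disjoint

    ends-unique : Unique (map (pathEnd Γ) paths)
    ends-unique = AllPairsₚ.map⁺ (AllPairs.map
      (λ {p} {q} disj eq → disj (∈-walk-end _ _) (subst (_∈L pathVertices Γ q) (sym eq) (∈-walk-end _ _)))
      disjoint)

    starts-unique : Unique (map Path.start paths)
    starts-unique = AllPairsₚ.map⁺ (AllPairs.map (λ disj eq → disj (ListAny.here refl) (ListAny.here eq)) disjoint)

    pathEndingAt : ∀ {v} → v ∈ J → ∃ λ p → p ∈L paths × pathEnd Γ p ≡ v
    pathEndingAt v∈J with ∈-map⁻ (pathEnd Γ) (∈-saturatedList J (map (pathEnd Γ) paths) ends-unique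
                            (Allₚ.map⁺ ends) (trans (length-map _ paths) (trans count ∣I∣≡∣J∣)) v∈J)
    ... | p , p∈ , v≡end = p , p∈ , sym v≡end

    pathStartingAt : ∀ {v} → v ∈ I → ∃ λ p → p ∈L paths × Path.start p ≡ v
    pathStartingAt v∈I with ∈-map⁻ Path.start (∈-saturatedList I (map Path.start paths) starts-unique
                              (Allₚ.map⁺ starts) (trans (length-map _ paths) count) v∈I)
    ... | p , p∈ , v≡start = p , p∈ , sym v≡start

    src∉J : ∀ {e} → e ∈L edges → src e ∉ J
    src∉J e∈ src∈J with ∈-allEdges⁻ paths e∈
    ... | p , p∈ , e∈p with pathEndingAt src∈J
    ...   | q , q∈ , end≡src with samePath disjoint p∈ q∈ (∈-walk-src _ _ (Path.walk p) e∈p)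
                                  (subst (_∈L pathVertices Γ q) end≡src (∈-walk-end _ _))
    ...     | refl = walk-src≢end _ _ (Path.walk p) (Path.simple p) e∈p (sym end≡src)

    tgt∉I : ∀ {e} → e ∈L edges → tgt e ∉ I
    tgt∉I e∈ tgt∈I with ∈-allEdges⁻ paths e∈
    ... | p , p∈ , e∈p with pathStartingAt tgt∈I
    ...   | q , q∈ , start≡tgt with samePath disjoint p∈ q∈ (∈-walk-tgt _ _ e∈p) (ListAny.here (sym start≡tgt))
    ...     | refl = walk-tgt≢start _ _ (Path.simple p) e∈p (sym start≡tgt)

    tgt≢src : ∀ {e} → e ∈L edges → tgt e ≢ src e
    tgt≢src e∈ with ∈-allEdges⁻ paths e∈
    ... | p , p∈ , e∈p = walk-tgt≢src _ _ (Path.walk p) (Path.simple p) e∈p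

    leaves : ∀ {p u} → p ∈L paths → u ∈L pathVertices Γ p → u ∉ J → ∃ λ e → e ∈L edges × src e ≡ u
    leaves {p} p∈ u∈ u∉J with walk-leaves _ _ (Path.walk p) u∈
                                (λ u≡end → u∉J (subst (_∈ J) (sym u≡end) (All.lookup ends p∈)))
    ... | e , e∈ , src≡u = e , ∈-allEdges⁺ paths p∈ e∈ , src≡u

    enters : ∀ {p v} → p ∈L paths → v ∈L pathVertices Γ p → v ∉ I → ∃ λ e → e ∈L edges × tgt e ≡ v
    enters {p} p∈ v∈ v∉I with walk-enters _ _ v∈ (λ v≡start → v∉I (subst (_∈ I) (sym v≡start) (All.lookup starts p∈)))
    ... | e , e∈ , tgt≡v = e , ∈-allEdges⁺ paths p∈ e∈ , tgt≡v

    source-leaves : ∀ {u} → u ∈ I → u ∉ J → ∃ λ e → e ∈L edges × src e ≡ u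
    source-leaves u∈I with pathStartingAt u∈I
    ... | p , p∈ , refl = leaves p∈ (ListAny.here refl)

    sink-entered : ∀ {v} → v ∈ J → v ∉ I → ∃ λ e → e ∈L edges × tgt e ≡ v
    sink-entered v∈J with pathEndingAt v∈J
    ... | p , p∈ , refl = enters p∈ (∈-walk-end _ _)

    src-entered : ∀ {e v} → e ∈L edges → src e ≡ v → v ∉ I → ∃ λ e′ → e′ ∈L edges × tgt e′ ≡ v
    src-entered e∈ refl with ∈-allEdges⁻ paths e∈
    ... | p , p∈ , e∈p = enters p∈ (∈-walk-src _ _ (Path.walk p) e∈p)

    tgt-leaves : ∀ {e u} → e ∈L edges → tgt e ≡ u → u ∉ J → ∃ λ e′ → e′ ∈L edges × src e′ ≡ u
    tgt-leaves e∈ refl with ∈-allEdges⁻ paths e∈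
    ... | p , p∈ , e∈p = leaves p∈ (∈-walk-tgt _ _ e∈p)

    out in′ : Fin m → Maybe (Fin nE)
    out = outEdge edges
    in′ = inEdge edges

    out-just : ∀ {u e} → out u ≡ just e → e ∈L edges × src e ≡ u
    out-just {u} = find-just (λ e → src e ≟F u) edges

    in-just : ∀ {v e} → in′ v ≡ just e → e ∈L edges × tgt e ≡ v
    in-just {v} = find-just (λ e → tgt e ≟F v) edges

    out-nothing : ∀ {u} → out u ≡ nothing → ∀ {e} → e ∈L edges → src e ≢ u
    out-nothing {u} = find-nothing (λ e → src e ≟F u) edges

    in-nothing : ∀ {v} → in′ v ≡ nothing → ∀ {e} → e ∈L edges → tgt e ≢ v
    in-nothing {v} = find-nothing (λ e → tgt e ≟F v) edges

    out-src : ∀ {e} → e ∈L edges → out (src e) ≡ just e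
    out-src {e} e∈ with out (src e) in eq
    ... | nothing = ⊥-elim (out-nothing eq e∈ refl)
    ... | just e′ = cong just
      (map-unique⇒injective src edges srcs-unique (proj₁ (out-just eq)) e∈ (proj₂ (out-just eq)))

    in-tgt : ∀ {e} → e ∈L edges → in′ (tgt e) ≡ just e
    in-tgt {e} e∈ with in′ (tgt e) in eq
    ... | nothing = ⊥-elim (in-nothing eq e∈ refl)
    ... | just e′ = cong just
      (map-unique⇒injective tgt edges tgts-unique (proj₁ (in-just eq)) e∈ (proj₂ (in-just eq)))

    σ τ : Fin m → Fin m
    σ u = maybe tgt u (out u)
    τ v = maybe src v (in′ v)

    σ-fixes : ∀ u → u ∈ J → σ u ≡ u
    σ-fixes u u∈J with out u in eq
    ... | nothing = refl
    ... | just e  = ⊥-elim (src∉J (proj₁ (out-just eq)) (subst (_∈ J) (sym (proj₂ (out-just eq))) u∈J))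

    σ-avoids : ∀ u → u ∉ J → σ u ∉ I
    σ-avoids u u∉J with out u in eq
    ... | just e  = tgt∉I (proj₁ (out-just eq))
    ... | nothing = λ u∈I → let e , e∈ , src≡u = source-leaves u∈I u∉J in out-nothing eq e∈ src≡u

    τ-avoids : ∀ v → v ∉ I → τ v ∉ J
    τ-avoids v v∉I with in′ v in eq
    ... | just e  = src∉J (proj₁ (in-just eq))
    ... | nothing = λ v∈J → let e , e∈ , tgt≡v = sink-entered v∈J v∉I in in-nothing eq e∈ tgt≡v

    τ∘σ : ∀ u → u ∉ J → τ (σ u) ≡ u
    τ∘σ u u∉J with out u in eq
    ... | just e  = trans (cong (maybe src (tgt e)) (in-tgt (proj₁ (out-just eq)))) (proj₂ (out-just eq))
    ... | nothing with in′ u in eq′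
    ...   | nothing = refl
    ...   | just e′ = ⊥-elim (let e , e∈ , src≡u = tgt-leaves (proj₁ (in-just eq′)) (proj₂ (in-just eq′)) u∉J
                              in out-nothing eq e∈ src≡u)

    σ∘τ : ∀ v → v ∉ I → σ (τ v) ≡ v
    σ∘τ v v∉I with in′ v in eq
    ... | just e  = trans (cong (maybe tgt (src e)) (out-src (proj₁ (in-just eq)))) (proj₂ (in-just eq))
    ... | nothing with out v in eq′
    ...   | nothing = refl
    ...   | just e′ = ⊥-elim (let e , e∈ , tgt≡v = src-entered (proj₁ (out-just eq′)) (proj₂ (out-just eq′)) v∉I
                              in in-nothing eq e∈ tgt≡v)

    out-just′ : ∀ u e → out u ≡ just e → src e ≡ u × tgt e ≡ σ u × σ u ≢ u
    out-just′ u e eq = proj₂ (out-just eq) , sym (cong (maybe tgt u) eq) ,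
      λ σu≡u → tgt≢src (proj₁ (out-just eq))
                 (trans (trans (sym (cong (maybe tgt u) eq)) σu≡u) (sym (proj₂ (out-just eq))))

    flow : Flow Γ (_∈ I) (_∈ J)
    flow = record
      { σ = σ ; τ = τ ; edge = out
      ; σ-fixes = σ-fixes ; σ-avoids = σ-avoids ; τ-avoids = τ-avoids
      ; τ∘σ = τ∘σ ; σ∘τ = σ∘τ
      ; edge-nothing = λ u → cong (maybe tgt u) ; edge-just = out-just′ }

    linkingWeight≡ : ∀ ps → foldr (λ p r → edgesWeight G Γ w (Path.edges p) + r) 0# ps ≡
                            edgesWeight G Γ w (allEdges ps)
    linkingWeight≡ []       = refl
    linkingWeight≡ (p ∷ ps) =
      trans (cong (_ +_) (linkingWeight≡ ps)) (sym (edgesWeight-++ (Path.edges p) (allEdges ps)))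

    flowWeight≡linkingWeight : flowWeight flow ≡ linkingWeight G Γ w L
    flowWeight≡linkingWeight = trans (sum-outEdge edges srcs-unique) (sym (linkingWeight≡ paths))

module Extended {c ℓ} (G : OrderedAbelianGroup c ℓ) where
  open OrderedAbelianGroup G renaming (_≤_ to _≤G_)
  open IsTotalOrder isTotalOrder using (total) renaming (refl to ≤G-refl; trans to ≤G-trans; antisym to ≤G-antisym)

  ≤∞-refl : ∀ x → _≤∞_ G x x
  ≤∞-refl (fin x) = fin≤fin ≤G-refl
  ≤∞-refl ∞       = ∞ ≤∞∞

  ≤∞-trans : ∀ {x y z} → _≤∞_ G x y → _≤∞_ G y z → _≤∞_ G x z
  ≤∞-trans (fin≤fin x≤y) (fin≤fin y≤z) = fin≤fin (≤G-trans x≤y y≤z)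
  ≤∞-trans _             (z ≤∞∞)       = _ ≤∞∞

  ≤∞-total : ∀ x y → _≤∞_ G x y ⊎ _≤∞_ G y x
  ≤∞-total (fin x) (fin y) = Data.Sum.map fin≤fin fin≤fin (total x y)
  ≤∞-total x       ∞       = inj₁ (x ≤∞∞)
  ≤∞-total ∞       y       = inj₂ (y ≤∞∞)

  ≤∞-antisym : ∀ {x y} → _≤∞_ G x y → _≤∞_ G y x → x ≡ y
  ≤∞-antisym (fin≤fin x≤y) (fin≤fin y≤x) = cong fin (≤G-antisym x≤y y≤x)
  ≤∞-antisym (∞ ≤∞∞)       _             = refl

  ≡∞? : (x : G∞ G) → Dec (x ≡ ∞)
  ≡∞? (fin x) = no λ ()
  ≡∞? ∞       = yes refl

  ∞≤⇒≡∞ : ∀ {x} → _≤∞_ G ∞ x → x ≡ ∞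
  ∞≤⇒≡∞ (∞ ≤∞∞) = refl

  +∞-zeroʳ : ∀ x → _+∞_ G x ∞ ≡ ∞
  +∞-zeroʳ (fin x) = refl
  +∞-zeroʳ ∞       = refl

  argmin : ∀ {n} (C : Fin n → Set) → (∀ j → Dec (C j)) → (f : Fin n → G∞ G) → (xs : List (Fin n)) →
           (∃ λ j → C j × ∀ {i} → i ∈L xs → C i → _≤∞_ G (f j) (f i)) ⊎ (∀ {i} → i ∈L xs → ¬ C i)
  argmin C C? f [] = inj₂ λ ()
  argmin C C? f (x ∷ xs) with argmin C C? f xs | C? x
  ... | inj₂ none            | no ¬Cx = inj₂ λ { (ListAny.here refl) → ¬Cx ; (ListAny.there i∈) → none i∈ }
  ... | inj₂ none            | yes Cx = inj₁ (x , Cx , λ { (ListAny.here refl) _ → ≤∞-refl _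
                                                      ; (ListAny.there i∈) Ci → ⊥-elim (none i∈ Ci) })
  ... | inj₁ (j , Cj , least) | no ¬Cx = inj₁ (j , Cj , λ { (ListAny.here refl) Cx → ⊥-elim (¬Cx Cx)
                                                         ; (ListAny.there i∈) → least i∈ })
  ... | inj₁ (j , Cj , least) | yes Cx with ≤∞-total (f x) (f j)
  ...   | inj₁ fx≤fj = inj₁ (x , Cx , λ { (ListAny.here refl) _ → ≤∞-refl _
                                      ; (ListAny.there i∈) Ci → ≤∞-trans fx≤fj (least i∈ Ci) })
  ...   | inj₂ fj≤fx = inj₁ (j , Cj , λ { (ListAny.here refl) _ → fj≤fx ; (ListAny.there i∈) → least i∈ })

  minInfOrTwice : ∀ {n} (S T : Subset n) (f : Fin n → G∞ G) →
                  (∀ j → j ∈ T → j ∉ S → f j ≢ ∞ → ∃ λ j′ → j′ ∈ T × j′ ∉ S × j′ ≢ j × _≤∞_ G (f j′) (f j)) →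
                  MinInfOrTwice G S T f
  minInfOrTwice {n} S T f improve with argmin (λ j → j ∈ T × j ∉ S) (λ j → (j ∈? T) ×-dec ¬? (j ∈? S)) f (allFin n)
  ... | inj₂ none = inj₁ λ j j∈T j∉S → ⊥-elim (none (∈-allFin j) (j∈T , j∉S))
  ... | inj₁ (j , (j∈T , j∉S) , least) with ≡∞? (f j)
  ...   | yes fj≡∞ = inj₁ λ i i∈T i∉S →
            ∞≤⇒≡∞ (subst (λ x → _≤∞_ G x (f i)) fj≡∞ (least (∈-allFin i) (i∈T , i∉S)))
  ...   | no fj≢∞ with improve j j∈T j∉S fj≢∞
  ...     | j′ , j′∈T , j′∉S , j′≢j , fj′≤fj = inj₂ (j , j′ , j′≢j ∘ sym , j∈T , j∉S , j′∈T , j′∉S ,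
              ≤∞-antisym (least (∈-allFin j′) (j′∈T , j′∉S)) fj′≤fj ,
              λ i i∈T i∉S → least (∈-allFin i) (i∈T , i∉S))

module LinkingValuation {c ℓ} (G : OrderedAbelianGroup c ℓ) (n r : ℕ) (Γ : Digraph (n ℕ.+ r))
  (w : Fin (Digraph.nE Γ) → OrderedAbelianGroup.Carrier G) (noNeg : NoNegativeCycle G Γ w)
  (s : ℕ) (d : Fin s → ℕ) (S : Fin s → Subset (n ℕ.+ r))
  (S-mono : ∀ k l → k ≤F l → S k ⊆ S l) (S-card : ∀ k → ∣ S k ∣ ≡ d k)
  (μ : Fin s → Subset n → G∞ G)
  (μ-min : ∀ k (I : Subset n) → ∣ I ∣ ≡ d k → IsMinLinkingWeight G Γ w (embedSub r I) (S k) (μ k I)) where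
  open OrderedAbelianGroup G renaming (_≤_ to _≤G_)
  open IsTotalOrder isTotalOrder using () renaming (reflexive to ≤G-reflexive; trans to ≤G-trans)
  open Sums G using (+-mono-≤)
  open FlowWeights G Γ w using (flowWeight; flowWeight-swap)
  open FlowsToLinkings G Γ w using (LinkingInside; flow⇒linking)
  open LinkingsToFlows G Γ w using (module LinkingFlow)
  open Extended G

  μ-finite : ∀ k (I : Subset n) → ∣ I ∣ ≡ d k → Linking Γ (embedSub r I) (S k) → μ k I ≢ ∞
  μ-finite k I ∣I∣≡d L with μ-min k I ∣I∣≡d
  ... | inj₁ (no-linking , _) = ⊥-elim (no-linking L)
  ... | inj₂ (_ , μ≡ , _)     = λ μ≡∞ → fin≢∞ (trans (sym μ≡) μ≡∞)
    where fin≢∞ : ∀ {x} → fin x ≢ ∞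
          fin≢∞ ()

  μ≤linkingWeight : ∀ k (I : Subset n) → ∣ I ∣ ≡ d k → (L : Linking Γ (embedSub r I) (S k)) →
                    ∃ λ a → μ k I ≡ fin a × a ≤G linkingWeight G Γ w L
  μ≤linkingWeight k I ∣I∣≡d L with μ-min k I ∣I∣≡d
  ... | inj₁ (no-linking , _)  = ⊥-elim (no-linking L)
  ... | inj₂ (_ , μ≡ , minimal) = _ , μ≡ , minimal L

  exchangeValue : Fin s → Fin s → Subset n → Subset n → Fin n → G∞ G
  exchangeValue k l X Y j = _+∞_ G (μ k (X ∪ ⁅ j ⁆)) (μ l (Y - j))

  module _ (k l : Fin s) (k≤l : k ≤F l) (X Y : Subset n)
           (∣X∣+1≡d : suc ∣ X ∣ ≡ d k) (∣Y∣≡d+1 : ∣ Y ∣ ≡ suc (d l)) where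

    ∣X∪⁅j⁆∣ : ∀ {j} → j ∉ X → ∣ X ∪ ⁅ j ⁆ ∣ ≡ d k
    ∣X∪⁅j⁆∣ j∉X = trans (x∉p⇒∣p∪⁅x⁆∣≡∣p∣+1 X j∉X) ∣X∣+1≡d

    ∣Y-j∣ : ∀ {j} → j ∈ Y → ∣ Y - j ∣ ≡ d l
    ∣Y-j∣ j∈Y = ℕP.suc-injective (trans (x∈p⇒∣p-x∣+1≡∣p∣ Y j∈Y) ∣Y∣≡d+1)

    module ExchangeLinkings {j} (j∈Y : j ∈ Y) (j∉X : j ∉ X)
      (L₁ : Linking Γ (embedSub r (X ∪ ⁅ j ⁆)) (S k)) (L₂ : Linking Γ (embedSub r (Y - j)) (S l)) where

      j↑∉X : ¬ (j ↑ˡ r ∈ embedSub r X)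
      j↑∉X j↑∈ with ∈-embedSub⁻ r X j↑∈
      ... | i , eq , i∈X = j∉X (subst (_∈ X) (sym (↑ˡ-injective r j i eq)) i∈X)

      module F₁ = LinkingFlow (embedSub r (X ∪ ⁅ j ⁆)) (S k) L₁
                    (trans (∣embedSub∣ r (X ∪ ⁅ j ⁆)) (trans (∣X∪⁅j⁆∣ j∉X) (sym (S-card k))))
      module F₂ = LinkingFlow (embedSub r (Y - j)) (S l) L₂
                    (trans (∣embedSub∣ r (Y - j)) (trans (∣Y-j∣ j∈Y) (sym (S-card l))))

      M₁ : Flow Γ (λ v → v ≡ j ↑ˡ r ⊎ v ∈ embedSub r X) (_∈ S k)
      M₁ = reindexSources Γ (∈-embedSub∪⁅⁆⁺ r X j) (∈-embedSub∪⁅⁆⁻ r X j) F₁.flow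

      M₂ : Flow Γ (λ v → v ∈ embedSub r Y × v ≢ j ↑ˡ r) (_∈ S l)
      M₂ = reindexSources Γ (∈-embedSub-⁺ r Y j) (∈-embedSub-⁻ r Y j) F₂.flow

      result : ∃ λ j′ → j′ ∈ Y × j′ ∉ X × j′ ≢ j ×
                 _≤∞_ G (exchangeValue k l X Y j′) (fin (linkingWeight G Γ w L₁ + linkingWeight G Γ w L₂))
      result with exchange Γ (_∈ embedSub r X) (_∈ embedSub r Y) (_∈ S k) (_∈ S l) (_∈? embedSub r Y)
                          (S-mono k l k≤l) (j ↑ˡ r) (∈-embedSub⁺ r Y j∈Y) j↑∉X M₁ M₂
      ... | t , t∈Y , t∉X , t≢j , M₁′ , M₂′ , swapped with ∈-embedSub⁻ r Y t∈Y
      ...   | t′ , refl , t′∈Y = t′ , t′∈Y , t′∉X , t′≢j , bound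
        where
        t′∉X : t′ ∉ X
        t′∉X = t∉X ∘ ∈-embedSub⁺ r X
        t′≢j : t′ ≢ j
        t′≢j = t≢j ∘ cong (_↑ˡ r)
        N₁ : Flow Γ (_∈ embedSub r (X ∪ ⁅ t′ ⁆)) (_∈ S k)
        N₁ = reindexSources Γ (∈-embedSub∪⁅⁆⁻ r X t′) (∈-embedSub∪⁅⁆⁺ r X t′) M₁′
        N₂ : Flow Γ (_∈ embedSub r (Y - t′)) (_∈ S l)
        N₂ = reindexSources Γ (∈-embedSub-⁻ r Y t′) (∈-embedSub-⁺ r Y t′) M₂′
        K₁ : LinkingInside N₁
        K₁ = flow⇒linking noNeg N₁
        K₂ : LinkingInside N₂
        K₂ = flow⇒linking noNeg N₂
        weights : flowWeight M₁′ + flowWeight M₂′ ≡ linkingWeight G Γ w L₁ + linkingWeight G Γ w L₂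
        weights = trans (flowWeight-swap M₁ M₂ M₁′ M₂′ swapped)
                        (cong₂ _+_ F₁.flowWeight≡linkingWeight F₂.flowWeight≡linkingWeight)
        bound : _≤∞_ G (exchangeValue k l X Y t′) (fin (linkingWeight G Γ w L₁ + linkingWeight G Γ w L₂))
        bound with μ≤linkingWeight k (X ∪ ⁅ t′ ⁆) (∣X∪⁅j⁆∣ t′∉X) (LinkingInside.linking K₁)
                 | μ≤linkingWeight l (Y - t′) (∣Y-j∣ t′∈Y) (LinkingInside.linking K₂)
        ... | a₁ , μ₁≡ , a₁≤ | a₂ , μ₂≡ , a₂≤ =
          subst₂ (λ x y → _≤∞_ G (_+∞_ G x y) _) (sym μ₁≡) (sym μ₂≡)
            (fin≤fin (≤G-trans (+-mono-≤ (≤G-trans a₁≤ (LinkingInside.weight≤ K₁))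
                                         (≤G-trans a₂≤ (LinkingInside.weight≤ K₂)))
                               (≤G-reflexive weights)))

    improvable : ∀ j → j ∈ Y → j ∉ X → exchangeValue k l X Y j ≢ ∞ →
                 ∃ λ j′ → j′ ∈ Y × j′ ∉ X × j′ ≢ j × _≤∞_ G (exchangeValue k l X Y j′) (exchangeValue k l X Y j)
    improvable j j∈Y j∉X finite with μ-min k (X ∪ ⁅ j ⁆) (∣X∪⁅j⁆∣ j∉X) | μ-min l (Y - j) (∣Y-j∣ j∈Y)
    ... | inj₁ (_ , μ₁≡∞) | _ = ⊥-elim (finite (cong (λ x → _+∞_ G x (μ l (Y - j))) μ₁≡∞))
    ... | inj₂ _ | inj₁ (_ , μ₂≡∞) = ⊥-elim (finite (trans (cong (_+∞_ G (μ k (X ∪ ⁅ j ⁆))) μ₂≡∞) (+∞-zeroʳ _)))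
    ... | inj₂ (L₁ , μ₁≡ , _) | inj₂ (L₂ , μ₂≡ , _) with ExchangeLinkings.result j∈Y j∉X L₁ L₂
    ...   | j′ , j′∈Y , j′∉X , j′≢j , ≤sum = j′ , j′∈Y , j′∉X , j′≢j ,
            subst (_≤∞_ G (exchangeValue k l X Y j′)) (sym (cong₂ (_+∞_ G) μ₁≡ μ₂≡)) ≤sum

    exchangeValue-minInfOrTwice : MinInfOrTwice G X Y (exchangeValue k l X Y)
    exchangeValue-minInfOrTwice = minInfOrTwice X Y (exchangeValue k l X Y) improvable


open import Data.Nat using (_+_)

theorem7p1 : ∀ {c ℓ} (G : OrderedAbelianGroup c ℓ)
    (n r : ℕ) (Γ : Digraph (n + r))
    (w : Fin (Digraph.nE Γ) → OrderedAbelianGroup.Carrier G)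
    → NoNegativeCycle G Γ w
    → (s : ℕ) (d : Fin s → ℕ) (S : Fin s → Subset (n + r))
    → (∀ k l → k <F l → d k < d l)
    → (∀ k l → k ≤F l → S k ⊆ S l)
    → (∀ k → ∣ S k ∣ ≡ d k)
    → (∀ k → Σ (Subset n) λ I → ∣ I ∣ ≡ d k × Linking Γ (embedSub r I) (S k))
    → (μ : Fin s → Subset n → G∞ G)
    → (∀ k (I : Subset n) → ∣ I ∣ ≡ d k → IsMinLinkingWeight G Γ w (embedSub r I) (S k) (μ k I))
    → IsValuatedFlagMatroid G n s d μ
theorem7p1 G n r Γ w noNeg s d S _ S-mono S-card linkable μ μ-min =
  (λ k → basis k , exchangeValue-minInfOrTwice k k ℕP.≤-refl) ,
  (λ k l k<l → exchangeValue-minInfOrTwice k l (ℕP.<⇒≤ k<l))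
  where
  open LinkingValuation G n r Γ w noNeg s d S S-mono S-card μ μ-min
  basis : ∀ k → Σ (Subset n) λ B → ∣ B ∣ ≡ d k × μ k B ≢ ∞
  basis k with linkable k
  ... | I , ∣I∣≡d , L = I , ∣I∣≡d , μ-finite k I ∣I∣≡d L
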